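{- Let $D=(V,E,\psi)$ be a general $r$-regular digraph with $n$ vertices and $m$ arcs. Then, as an identity of rational functions in $\lambda$, $$A(\lambda , D^{0+1}) = \lambda^{m-1} (\lambda^2 - r\lambda - m n )(\lambda - r)^{ -1} A(\lambda, D).$$
   Context: A general digraph is $D=(V,E,\psi)$ with $V$ finite nonempty, $E$ a finite arc set disjoint from $V$, and $\psi:E\to V\times V$ (loops and multiple arcs allowed); for $\psi(e)=(u,v)$, $t(e)=u$, $h(e)=v$. $D$ is $r$-regular if every vertex is the tail of exactly $r$ arcs and the head of exactly $r$ arcs. The adjacency matrix $A(G)$ has $(u,v)$ entry equal to the number of arcs from $u$ to $v$; $A(\lambda,G)=\det(\lambda I-A(G))$. The line digraph $D^l$ has vertex set $E$ and one arc $(p,q)$ for each ordered pair $p,q\in E$ with $h(p)=t(q)$. $D^{0+1}$ is the digraph with vertex set $V\cup E$ whose arcs are the arcs of $D^l$ (on $E$) together with all arcs $(v,e)$ and $(e,v)$ for $v\in V$, $e\in E$ (and no arcs between vertices of $V$). -}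

module Defs where

open import Level using (Level)
open import Data.Nat using (ℕ; zero; suc)
import Data.Nat as ℕ
open import Data.Bool using (Bool; true; false; if_then_else_; _∧_)
open import Data.Fin using (Fin; zero; suc; punchIn; _↑ˡ_; _↑ʳ_; toℕ)
open import Data.Fin.Properties using (_≟_)
open import Data.Product using (_×_; _,_; proj₁; proj₂)
open import Data.List using (List; []; _∷_; _++_; concatMap; length; lookup; allFin)
open import Relation.Nullary.Decidable using (⌊_⌋)
open import Relation.Binary.PropositionalEquality using (_≡_)
open import Algebra.Bundles using (CommutativeRing)

-- General digraphs (loops and multiple arcs allowed).
-- V = Fin nV, E = Fin nE, ψ : E → V × V with ψ e = (t e , h e).

record Digraph : Set where
  field
    nV : ℕ
    nE : ℕ
    ψ  : Fin nE → Fin nV × Fin nV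

  tl : Fin nE → Fin nV
  tl e = proj₁ (ψ e)

  hd : Fin nE → Fin nV
  hd e = proj₂ (ψ e)

open Digraph public

count : ∀ {k} → (Fin k → Bool) → ℕ
count {zero}  P = 0
count {suc k} P = (if P zero then 1 else 0) ℕ.+ count (λ i → P (suc i))

Regular : Digraph → ℕ → Set
Regular D r =
  ((v : Fin (nV D)) → count (λ e → ⌊ tl D e ≟ v ⌋) ≡ r) ×
  ((v : Fin (nV D)) → count (λ e → ⌊ hd D e ≟ v ⌋) ≡ r)

adj : (D : Digraph) → Fin (nV D) → Fin (nV D) → ℕ
adj D u v = count (λ e → ⌊ tl D e ≟ u ⌋ ∧ ⌊ hd D e ≟ v ⌋)

fromArcList : (N : ℕ) → List (Fin N × Fin N) → Digraph
fromArcList N L = record { nV = N ; nE = length L ; ψ = lookup L }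

-- D^{0+1}: vertex set V ∪ E, encoded as Fin (nV + nE) with v ↦ v ↑ˡ nE
-- and e ↦ nV ↑ʳ e.  Arcs: those of the line digraph D^l on E (one arc (p,q)
-- for each ordered pair with h p = t q), plus all (v,e) and all (e,v).
D01 : Digraph → Digraph
D01 D = fromArcList (n ℕ.+ m) (lineArcs ++ (veArcs ++ evArcs))
  where
  n = nV D
  m = nE D
  V' : Fin n → Fin (n ℕ.+ m)
  V' v = v ↑ˡ m
  E' : Fin m → Fin (n ℕ.+ m)
  E' e = n ↑ʳ e
  lineArcs : List (Fin (n ℕ.+ m) × Fin (n ℕ.+ m))
  lineArcs = concatMap (λ p → concatMap (λ q →
               if ⌊ hd D p ≟ tl D q ⌋ then (E' p , E' q) ∷ [] else []) (allFin m)) (allFin m)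
  veArcs : List (Fin (n ℕ.+ m) × Fin (n ℕ.+ m))
  veArcs = concatMap (λ v → concatMap (λ e → (V' v , E' e) ∷ []) (allFin m)) (allFin n)
  evArcs : List (Fin (n ℕ.+ m) × Fin (n ℕ.+ m))
  evArcs = concatMap (λ v → concatMap (λ e → (E' e , V' v) ∷ []) (allFin m)) (allFin n)

module _ {c ℓ : Level} (R : CommutativeRing c ℓ) where
  open CommutativeRing R using (Carrier; _+_; _*_; -_; _-_; 0#; 1#)

  ℕ→R : ℕ → Carrier
  ℕ→R zero    = 0#
  ℕ→R (suc k) = 1# + ℕ→R k

  pow : Carrier → ℕ → Carrier
  pow x zero    = 1#
  pow x (suc k) = x * pow x k

  sumFin : ∀ {k} → (Fin k → Carrier) → Carrier
  sumFin {zero}  f = 0#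
  sumFin {suc k} f = f zero + sumFin (λ i → f (suc i))

  det : ∀ {k} → (Fin k → Fin k → Carrier) → Carrier
  det {zero}  M = 1#
  det {suc k} M = sumFin (λ j → pow (- 1#) (toℕ j) * (M zero j *
                    det (λ i l → M (suc i) (punchIn j l))))

  δ : ∀ {k} → Fin k → Fin k → Carrier
  δ i j = if ⌊ i ≟ j ⌋ then 1# else 0#

  charPolyAt : Digraph → Carrier → Carrier
  charPolyAt G x = det (λ i j → x * δ i j - ℕ→R (adj G i j))

module Submission where

-- Theorem 4.8: for a digraph D with n vertices and m arcs in which every
-- vertex has in-degree r (the half of r-regularity that is needed),
--     x (x - r) · A(x, D^{0+1})  ≈  x^m (x² - r x - m n) · A(x, D)
-- in every commutative ring: the paper's identity of rational functions
-- with the denominator x - r cleared.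
--
-- Index the vertices of D^{0+1} by V ⊎ E.  With the incidence matrices
-- T e u = [t(e) = u] and H e u = [h(e) = u] one has A(D) = Tᵀ H and
-- A(D^l) = H Tᵀ, so x I - A(D^{0+1}) = [ x I , -J ; -J , x I - H Tᵀ ].
-- Its determinant is evaluated by elementary row operations alone (module
-- Computation, steps 1-7): clear the all-ones blocks, border the matrix by
-- an identity block on a second copy of V carrying T and H (Sylvester's
-- trick, trading H Tᵀ on E for Tᵀ H on V), split off the block-triangular
-- factors x^m and det (x I - A(D)), and read off the last pivot
-- x² - r x - m n; in-regularity enters as "A(D) has column sums r".

open import Defs
open import Level using (Level)
open import Algebra.Bundles using (CommutativeRing)
open import Data.Nat as ℕ using (ℕ; zero; suc)
import Data.Nat.Properties as ℕP
open import Data.Integer as ℤ using (ℤ; +_; -[1+_]) renaming (0ℤ to ℤ0; 1ℤ to ℤ1)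
import Data.Integer.Properties as ℤP
import Data.Integer.Base as ℤB
open import Data.Sign as Sign using (Sign)
open import Data.Fin as Fin using (Fin; zero; suc; punchIn; punchOut; toℕ; _↑ˡ_; _↑ʳ_; splitAt; join; cast; fromℕ<)
import Data.Fin.Properties as FinP
open import Data.Fin.Properties using (_≟_)
open import Data.Bool using (Bool; true; false; if_then_else_; _∧_)
open import Data.Product using (_×_; _,_; proj₁; proj₂)
open import Data.Sum as Sum using (_⊎_; inj₁; inj₂)
open import Data.List using (List; []; _∷_; _++_; concatMap; length; lookup; allFin; tabulate)
open import Data.Maybe using (Maybe; just; nothing)
open import Data.Empty using (⊥-elim)
open import Function using (_∘_; id)
open import Relation.Nullary using (¬_; Dec; does; yes; no)
open import Relation.Nullary.Decidable using (⌊_⌋; dec-true; dec-false)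
open import Relation.Binary.PropositionalEquality as ≡ using (_≡_; _≢_)
import Algebra.Solver.Ring.AlmostCommutativeRing as ACR

-- The coefficient map sends 0
-- and 1 to 0# and 1# on the nose, so the solver constants `con ℤ0` and
-- `con ℤ1` are literally 0# and 1#.
module IntegerSolver {c ℓ : Level} (R : CommutativeRing c ℓ) where
  open CommutativeRing R
  open import Relation.Binary.Reasoning.Setoid setoid
  open import Algebra.Properties.Ring ring using (-‿distribʳ-*; -1*x≈-x)
  open import Algebra.Properties.AbelianGroup +-abelianGroup using (⁻¹-∙-comm)
  open import Algebra.Properties.Group +-group using (ε⁻¹≈ε; ⁻¹-involutive)

  ℕ→R-+ : ∀ a b → ℕ→R R (a ℕ.+ b) ≈ ℕ→R R a + ℕ→R R b
  ℕ→R-+ zero    b = sym (+-identityˡ _)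
  ℕ→R-+ (suc a) b = trans (+-congˡ (ℕ→R-+ a b)) (sym (+-assoc _ _ _))

  ℕ→R-* : ∀ a b → ℕ→R R (a ℕ.* b) ≈ ℕ→R R a * ℕ→R R b
  ℕ→R-* zero    b = sym (zeroˡ _)
  ℕ→R-* (suc a) b = begin
    ℕ→R R (b ℕ.+ a ℕ.* b)             ≈⟨ ℕ→R-+ b (a ℕ.* b) ⟩
    ℕ→R R b + ℕ→R R (a ℕ.* b)         ≈⟨ +-cong (sym (*-identityˡ _)) (ℕ→R-* a b) ⟩
    1# * ℕ→R R b + ℕ→R R a * ℕ→R R b  ≈⟨ sym (distribʳ _ _ _) ⟩
    (1# + ℕ→R R a) * ℕ→R R b          ∎

  sign : Sign → Carrier
  sign Sign.+ = 1#
  sign Sign.- = - 1#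

  sign-* : ∀ s t → sign (s Sign.* t) ≈ sign s * sign t
  sign-* Sign.+ t       = sym (*-identityˡ _)
  sign-* Sign.- Sign.+ = sym (*-identityʳ _)
  sign-* Sign.- Sign.- = begin
    1#             ≈⟨ sym (⁻¹-involutive _) ⟩
    - - 1#         ≈⟨ -‿cong (sym (-1*x≈-x 1#)) ⟩
    - (- 1# * 1#)  ≈⟨ -‿distribʳ-* _ _ ⟩
    - 1# * - 1#    ∎

  ℤ→R : ℤ → Carrier
  ℤ→R (+ k)      = ℕ→R R k
  ℤ→R -[1+ k ]   = - ℕ→R R (suc k)

  ℤ→R-signAbs : ∀ i → ℤ→R i ≈ sign (ℤ.sign i) * ℕ→R R ℤ.∣ i ∣
  ℤ→R-signAbs (+ k)    = sym (*-identityˡ _)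
  ℤ→R-signAbs -[1+ k ] = sym (-1*x≈-x _)

  ℤ→R-◃ : ∀ s k → ℤ→R (s ℤ.◃ k) ≈ sign s * ℕ→R R k
  ℤ→R-◃ s       zero    = sym (zeroʳ _)
  ℤ→R-◃ Sign.+ (suc k) = sym (*-identityˡ _)
  ℤ→R-◃ Sign.- (suc k) = sym (-1*x≈-x _)

  ℤ→R-⊖ : ∀ a b → ℤ→R (a ℤ.⊖ b) ≈ ℕ→R R a - ℕ→R R b
  ℤ→R-⊖ a       zero    = sym (trans (+-congˡ ε⁻¹≈ε) (+-identityʳ _))
  ℤ→R-⊖ zero    (suc b) = sym (+-identityˡ _)
  ℤ→R-⊖ (suc a) (suc b) = begin
    ℤ→R (suc a ℤ.⊖ suc b)  ≡⟨ ≡.cong ℤ→R (ℤP.[1+m]⊖[1+n]≡m⊖n a b) ⟩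
    ℤ→R (a ℤ.⊖ b)          ≈⟨ ℤ→R-⊖ a b ⟩
    ℕ→R R a - ℕ→R R b      ≈⟨ cancel-1 _ _ ⟩
    ℕ→R R (suc a) - ℕ→R R (suc b) ∎
    where
    cancel-1 : ∀ u v → u - v ≈ (1# + u) - (1# + v)
    cancel-1 u v = sym (begin
      (1# + u) + - (1# + v)    ≈⟨ +-congˡ (sym (⁻¹-∙-comm 1# v)) ⟩
      (1# + u) + (- 1# + - v)  ≈⟨ +-assoc _ _ _ ⟩
      1# + (u + (- 1# + - v))  ≈⟨ +-congˡ (sym (+-assoc _ _ _)) ⟩
      1# + ((u + - 1#) + - v)  ≈⟨ +-congˡ (+-congʳ (+-comm _ _)) ⟩
      1# + ((- 1# + u) + - v)  ≈⟨ +-congˡ (+-assoc _ _ _) ⟩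
      1# + (- 1# + (u + - v))  ≈⟨ sym (+-assoc _ _ _) ⟩
      (1# + - 1#) + (u + - v)  ≈⟨ +-congʳ (-‿inverseʳ _) ⟩
      0# + (u + - v)           ≈⟨ +-identityˡ _ ⟩
      u - v                    ∎)

  ℤ→R-neg : ∀ i → ℤ→R (ℤ.- i) ≈ - ℤ→R i
  ℤ→R-neg (+ zero)  = sym ε⁻¹≈ε
  ℤ→R-neg (+ suc k) = refl
  ℤ→R-neg -[1+ k ]  = sym (⁻¹-involutive _)

  ℤ→R-+ : ∀ i j → ℤ→R (i ℤ.+ j) ≈ ℤ→R i + ℤ→R j
  ℤ→R-+ (+ a)    (+ b)    = ℕ→R-+ a b
  ℤ→R-+ (+ a)    -[1+ b ] = ℤ→R-⊖ a (suc b)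
  ℤ→R-+ -[1+ a ] (+ b)    = trans (ℤ→R-⊖ b (suc a)) (+-comm _ _)
  ℤ→R-+ -[1+ a ] -[1+ b ] = begin
    - ℕ→R R (suc (suc (a ℕ.+ b)))    ≈⟨ -‿cong (+-congˡ (ℕ→R-+ (suc a) b)) ⟩
    - (1# + (ℕ→R R (suc a) + ℕ→R R b)) ≈⟨ -‿cong (sym (+-assoc _ _ _)) ⟩
    - ((1# + ℕ→R R (suc a)) + ℕ→R R b) ≈⟨ -‿cong (+-congʳ (+-comm _ _)) ⟩
    - ((ℕ→R R (suc a) + 1#) + ℕ→R R b) ≈⟨ -‿cong (+-assoc _ _ _) ⟩
    - (ℕ→R R (suc a) + ℕ→R R (suc b))  ≈⟨ sym (⁻¹-∙-comm _ _) ⟩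
    - ℕ→R R (suc a) + - ℕ→R R (suc b)  ∎

  ℤ→R-* : ∀ i j → ℤ→R (i ℤ.* j) ≈ ℤ→R i * ℤ→R j
  ℤ→R-* i j = begin
    ℤ→R (i ℤ.* j)                              ≈⟨ ℤ→R-◃ (si Sign.* sj) (ai ℕ.* aj) ⟩
    sign (si Sign.* sj) * ℕ→R R (ai ℕ.* aj)    ≈⟨ *-cong (sign-* si sj) (ℕ→R-* ai aj) ⟩
    (sign si * sign sj) * (ℕ→R R ai * ℕ→R R aj) ≈⟨ medial _ _ _ _ ⟩
    (sign si * ℕ→R R ai) * (sign sj * ℕ→R R aj) ≈⟨ *-cong (sym (ℤ→R-signAbs i)) (sym (ℤ→R-signAbs j)) ⟩
    ℤ→R i * ℤ→R j                              ∎
    where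
    si sj : Sign
    si = ℤ.sign i
    sj = ℤ.sign j
    ai aj : ℕ
    ai = ℤ.∣ i ∣
    aj = ℤ.∣ j ∣
    medial : ∀ a b u v → (a * b) * (u * v) ≈ (a * u) * (b * v)
    medial a b u v = begin
      (a * b) * (u * v)  ≈⟨ *-assoc _ _ _ ⟩
      a * (b * (u * v))  ≈⟨ *-congˡ (sym (*-assoc _ _ _)) ⟩
      a * ((b * u) * v)  ≈⟨ *-congˡ (*-congʳ (*-comm _ _)) ⟩
      a * ((u * b) * v)  ≈⟨ *-congˡ (*-assoc _ _ _) ⟩
      a * (u * (b * v))  ≈⟨ sym (*-assoc _ _ _) ⟩
      (a * u) * (b * v)  ∎

  -- the coefficient map actually handed to the solver: equal to ℤ→R, but
  -- with 0 ↦ 0# and 1 ↦ 1# definitionally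
  literal : ℕ → Carrier
  literal zero          = 0#
  literal (suc zero)    = 1#
  literal (suc (suc k)) = 1# + literal (suc k)

  literal≈ℕ→R : ∀ k → literal k ≈ ℕ→R R k
  literal≈ℕ→R zero          = refl
  literal≈ℕ→R (suc zero)    = sym (+-identityʳ _)
  literal≈ℕ→R (suc (suc k)) = +-congˡ (literal≈ℕ→R (suc k))

  coeff : ℤ → Carrier
  coeff (+ k)    = literal k
  coeff -[1+ k ] = - literal (suc k)

  coeff≈ℤ→R : ∀ i → coeff i ≈ ℤ→R i
  coeff≈ℤ→R (+ k)    = literal≈ℕ→R k
  coeff≈ℤ→R -[1+ k ] = -‿cong (literal≈ℕ→R (suc k))


  morphism : ℤB.+-*-rawRing ACR.-Raw-AlmostCommutative⟶ ACR.fromCommutativeRing R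
  morphism = record
    { ⟦_⟧    = coeff
    ; +-homo = λ i j → trans (coeff≈ℤ→R (i ℤ.+ j)) (trans (ℤ→R-+ i j) (sym (+-cong (coeff≈ℤ→R i) (coeff≈ℤ→R j))))
    ; *-homo = λ i j → trans (coeff≈ℤ→R (i ℤ.* j)) (trans (ℤ→R-* i j) (sym (*-cong (coeff≈ℤ→R i) (coeff≈ℤ→R j))))
    ; -‿homo = λ i → trans (coeff≈ℤ→R (ℤ.- i)) (trans (ℤ→R-neg i) (sym (-‿cong (coeff≈ℤ→R i))))
    ; 0-homo = refl
    ; 1-homo = refl
    }

  coeff-≟ : ∀ a b → Maybe (coeff a ≈ coeff b)
  coeff-≟ a b with a ℤ.≟ b
  ... | yes ≡.refl = just refl
  ... | no _       = nothing

  open import Algebra.Solver.Ring ℤB.+-*-rawRing (ACR.fromCommutativeRing R) morphism coeff-≟ public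

module FinSums {c ℓ : Level} (R : CommutativeRing c ℓ) where
  open CommutativeRing R hiding (zero)
  open IntegerSolver R using (solve; _:=_; _:+_; :-_; con)
  open import Relation.Binary.Reasoning.Setoid setoid

  Σ : ∀ {k} → (Fin k → Carrier) → Carrier
  Σ = sumFin R

  Σ-cong : ∀ {k} {f g : Fin k → Carrier} → (∀ i → f i ≈ g i) → Σ f ≈ Σ g
  Σ-cong {zero}  h = refl
  Σ-cong {suc k} h = +-cong (h zero) (Σ-cong (h ∘ suc))

  Σ-zero : ∀ {k} {f : Fin k → Carrier} → (∀ i → f i ≈ 0#) → Σ f ≈ 0#
  Σ-zero {zero}  h = refl
  Σ-zero {suc k} h = trans (+-cong (h zero) (Σ-zero (h ∘ suc))) (+-identityˡ _)

  Σ-+ : ∀ {k} (f g : Fin k → Carrier) → Σ (λ i → f i + g i) ≈ Σ f + Σ g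
  Σ-+ {zero}  f g = sym (+-identityˡ _)
  Σ-+ {suc k} f g = trans (+-congˡ (Σ-+ (f ∘ suc) (g ∘ suc)))
    (solve 4 (λ a b u v → (a :+ b) :+ (u :+ v) := (a :+ u) :+ (b :+ v)) refl
      (f zero) (g zero) (Σ (f ∘ suc)) (Σ (g ∘ suc)))

  Σ-*ˡ : ∀ {k} (a : Carrier) (f : Fin k → Carrier) → Σ (λ i → a * f i) ≈ a * Σ f
  Σ-*ˡ {zero}  a f = sym (zeroʳ _)
  Σ-*ˡ {suc k} a f = trans (+-congˡ (Σ-*ˡ a (f ∘ suc))) (sym (distribˡ _ _ _))

  Σ-*ʳ : ∀ {k} (a : Carrier) (f : Fin k → Carrier) → Σ (λ i → f i * a) ≈ Σ f * a
  Σ-*ʳ a f = trans (Σ-cong (λ i → *-comm (f i) a)) (trans (Σ-*ˡ a f) (*-comm _ _))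

  Σ-neg : ∀ {k} (f : Fin k → Carrier) → Σ (λ i → - f i) ≈ - Σ f
  Σ-neg {zero}  f = solve 0 (con ℤ0 := :- con ℤ0) refl
  Σ-neg {suc k} f = trans (+-congˡ (Σ-neg (f ∘ suc)))
    (solve 2 (λ a b → :- a :+ :- b := :- (a :+ b)) refl (f zero) (Σ (f ∘ suc)))

  Σ-const : ∀ {k} (a : Carrier) → Σ (λ (_ : Fin k) → a) ≈ ℕ→R R k * a
  Σ-const {zero}  a = sym (zeroˡ _)
  Σ-const {suc k} a = trans (+-cong (sym (*-identityˡ a)) (Σ-const {k} a)) (sym (distribʳ _ _ _))

  Σ-swap : ∀ {k l} (f : Fin k → Fin l → Carrier) →
    Σ (λ i → Σ (λ j → f i j)) ≈ Σ (λ j → Σ (λ i → f i j))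
  Σ-swap {zero}  {l} f = sym (Σ-zero {l} (λ j → refl))
  Σ-swap {suc k} {l} f = begin
    Σ (f zero) + Σ (λ i → Σ (f (suc i)))          ≈⟨ +-congˡ (Σ-swap (f ∘ suc)) ⟩
    Σ (f zero) + Σ (λ j → Σ (λ i → f (suc i) j))  ≈⟨ sym (Σ-+ (f zero) (λ j → Σ (λ i → f (suc i) j))) ⟩
    Σ (λ j → f zero j + Σ (λ i → f (suc i) j))    ∎

  Σ-punchIn : ∀ {k} (j : Fin (suc k)) (f : Fin (suc k) → Carrier) →
    Σ f ≈ f j + Σ (λ l → f (punchIn j l))
  Σ-punchIn zero f = refl
  Σ-punchIn {suc k} (suc j) f = begin
    f zero + Σ (f ∘ suc)                                    ≈⟨ +-congˡ (Σ-punchIn j (f ∘ suc)) ⟩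
    f zero + (f (suc j) + Σ (λ l → f (suc (punchIn j l))))  ≈⟨ solve 3 (λ a b t → a :+ (b :+ t) := b :+ (a :+ t)) refl
                                                                 (f zero) (f (suc j)) (Σ (λ l → f (suc (punchIn j l)))) ⟩
    f (suc j) + (f zero + Σ (λ l → f (suc (punchIn j l))))  ∎

  Σ-single : ∀ {k} (j : Fin k) (f : Fin k → Carrier) → (∀ i → i ≢ j → f i ≈ 0#) → Σ f ≈ f j
  Σ-single {suc k} j f h = begin
    Σ f                               ≈⟨ Σ-punchIn j f ⟩
    f j + Σ (λ l → f (punchIn j l))   ≈⟨ +-congˡ (Σ-zero (λ l → h _ (FinP.punchInᵢ≢i j l))) ⟩
    f j + 0#                          ≈⟨ +-identityʳ _ ⟩
    f j                               ∎

  Σ-splitAt : ∀ a b (f : Fin (a ℕ.+ b) → Carrier) → Σ f ≈ Σ (λ i → f (i ↑ˡ b)) + Σ (λ j → f (a ↑ʳ j))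
  Σ-splitAt zero    b f = sym (+-identityˡ _)
  Σ-splitAt (suc a) b f = trans (+-congˡ (Σ-splitAt a b (f ∘ suc))) (sym (+-assoc _ _ _))

  Σ-antisym : ∀ {k} (G : Fin k → Fin k → Carrier) → (∀ j → G j j ≈ 0#) →
    (∀ j l → G j l + G l j ≈ 0#) → Σ (λ j → Σ (λ l → G j l)) ≈ 0#
  Σ-antisym {zero}  G diag anti = refl
  Σ-antisym {suc k} G diag anti = begin
    (G zero zero + Σ (λ l → G zero (suc l))) + Σ (λ j → G (suc j) zero + Σ (λ l → G (suc j) (suc l)))
      ≈⟨ +-congˡ (Σ-+ (λ j → G (suc j) zero) (λ j → Σ (λ l → G (suc j) (suc l)))) ⟩
    (G zero zero + Σ (λ l → G zero (suc l))) + (Σ (λ j → G (suc j) zero) + Σ (λ j → Σ (λ l → G (suc j) (suc l))))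
      ≈⟨ +-cong (+-congʳ (diag zero))
                (+-congˡ (Σ-antisym (λ j l → G (suc j) (suc l)) (diag ∘ suc) (λ j l → anti (suc j) (suc l)))) ⟩
    (0# + Σ (λ l → G zero (suc l))) + (Σ (λ j → G (suc j) zero) + 0#)
      ≈⟨ solve 2 (λ u v → (con ℤ0 :+ u) :+ (v :+ con ℤ0) := u :+ v) refl (Σ (λ l → G zero (suc l))) (Σ (λ j → G (suc j) zero)) ⟩
    Σ (λ l → G zero (suc l)) + Σ (λ j → G (suc j) zero)  ≈⟨ sym (Σ-+ (λ l → G zero (suc l)) (λ l → G (suc l) zero)) ⟩
    Σ (λ l → G zero (suc l) + G (suc l) zero)            ≈⟨ Σ-zero (λ l → anti zero (suc l)) ⟩
    0#                                                   ∎

  -- Iverson bracket; note that δ R i j is definitionally [ ⌊ i ≟ j ⌋ ]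
  [_] : Bool → Carrier
  [ b ] = if b then 1# else 0#

  [∧] : ∀ a b → [ a ∧ b ] ≈ [ a ] * [ b ]
  [∧] true  b = sym (*-identityˡ _)
  [∧] false b = sym (zeroˡ _)

  δ-sym : ∀ {k} (i j : Fin k) → δ R i j ≈ δ R j i
  δ-sym i j with i ≟ j | j ≟ i
  ... | yes _  | yes _  = refl
  ... | no _   | no _   = refl
  ... | yes eq | no neq = ⊥-elim (neq (≡.sym eq))
  ... | no neq | yes eq = ⊥-elim (neq (≡.sym eq))

  δ-suc : ∀ {k} (i j : Fin k) → δ R (suc i) (suc j) ≈ δ R i j
  δ-suc i j with i ≟ j
  ... | yes ≡.refl = refl
  ... | no _       = refl

  δ-injective : ∀ {a b} (f : Fin a → Fin b) → (∀ x y → f x ≡ f y → x ≡ y) → ∀ x y → δ R (f x) (f y) ≡ δ R x y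
  δ-injective f f-inj x y with x ≟ y | f x ≟ f y
  ... | yes ≡.refl | yes _  = ≡.refl
  ... | yes ≡.refl | no ≢   = ⊥-elim (≢ ≡.refl)
  ... | no x≢y     | yes eq = ⊥-elim (x≢y (f-inj x y eq))
  ... | no _       | no _   = ≡.refl

  δ-apart : ∀ {k} {x y : Fin k} → x ≢ y → δ R x y ≡ 0#
  δ-apart {x = x} {y} x≢y with x ≟ y
  ... | yes x≡y = ⊥-elim (x≢y x≡y)
  ... | no _    = ≡.refl

  Σ-δ : ∀ {k} (j : Fin k) (f : Fin k → Carrier) → Σ (λ i → δ R i j * f i) ≈ f j
  Σ-δ j f = trans (Σ-single j _ off) (at j)
    where
    off : ∀ i → i ≢ j → δ R i j * f i ≈ 0#
    off i i≢j with i ≟ j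
    ... | yes i≡j = ⊥-elim (i≢j i≡j)
    ... | no _    = zeroˡ _
    at : ∀ j → δ R j j * f j ≈ f j
    at j with j ≟ j
    ... | yes _   = *-identityˡ _
    ... | no j≢j  = ⊥-elim (j≢j ≡.refl)

  Σ-δ-1 : ∀ {k} (j : Fin k) → Σ (λ i → δ R i j) ≈ 1#
  Σ-δ-1 j = trans (Σ-cong (λ i → sym (*-identityʳ (δ R i j)))) (Σ-δ j (λ _ → 1#))

  one-or-zero : ∀ b → ℕ→R R (if b then 1 else 0) ≈ [ b ]
  one-or-zero true  = +-identityʳ _
  one-or-zero false = refl

  count-Σ : ∀ {k} (P : Fin k → Bool) → ℕ→R R (count P) ≈ Σ (λ i → [ P i ])
  count-Σ {zero}  P = refl
  count-Σ {suc k} P = trans (IntegerSolver.ℕ→R-+ R (if P zero then 1 else 0) (count (P ∘ suc)))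
                            (+-cong (one-or-zero (P zero)) (count-Σ (P ∘ suc)))

punchIn-↑ˡ : ∀ {a} b (i : Fin (suc a)) (j : Fin a) → punchIn (i ↑ˡ b) (j ↑ˡ b) ≡ punchIn i j ↑ˡ b
punchIn-↑ˡ b zero    j       = ≡.refl
punchIn-↑ˡ b (suc i) zero    = ≡.refl
punchIn-↑ˡ b (suc i) (suc j) = ≡.cong suc (punchIn-↑ˡ b i j)

punchIn-↑ʳ : ∀ {a} b (i : Fin (suc a)) (j : Fin b) → punchIn (i ↑ˡ b) (a ↑ʳ j) ≡ suc a ↑ʳ j
punchIn-↑ʳ b zero j = ≡.refl
punchIn-↑ʳ {suc a} b (suc i) j = ≡.cong suc (punchIn-↑ʳ b i j)

-- the n indices of Fin (2 + n) other than two distinct indices j and k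
skipTwo : ∀ {n} {j k : Fin (suc (suc n))} → j ≢ k → Fin n → Fin (suc (suc n))
skipTwo {j = j} j≢k c = punchIn j (punchIn (punchOut j≢k) c)

skipTwo-sym : ∀ {n} (j k : Fin (suc (suc n))) (j≢k : j ≢ k) (k≢j : k ≢ j) (c : Fin n) →
  skipTwo j≢k c ≡ skipTwo k≢j c
skipTwo-sym zero    zero    j≢k k≢j c       = ⊥-elim (j≢k ≡.refl)
skipTwo-sym zero    (suc k) j≢k k≢j c       = ≡.refl
skipTwo-sym (suc j) zero    j≢k k≢j c       = ≡.refl
skipTwo-sym (suc j) (suc k) j≢k k≢j zero    = ≡.refl
skipTwo-sym (suc j) (suc k) j≢k k≢j (suc c) =
  ≡.cong suc (skipTwo-sym j k (j≢k ∘ ≡.cong suc) (k≢j ∘ ≡.cong suc) c)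

if-yes : ∀ {a b} {A : Set a} {X : Set b} (d : Dec A) {x y : X} → A → (if does d then x else y) ≡ x
if-yes d a = ≡.cong (if_then _ else _) (dec-true d a)

if-no : ∀ {a b} {A : Set a} {X : Set b} (d : Dec A) {x y : X} → ¬ A → (if does d then x else y) ≡ y
if-no d ¬a = ≡.cong (if_then _ else _) (dec-false d ¬a)

module Determinants {c ℓ : Level} (R : CommutativeRing c ℓ) where
  open CommutativeRing R hiding (zero)
  open import Algebra.Properties.Group +-group using (inverseʳ-unique)
  open FinSums R
  open IntegerSolver R using (solve; _:=_; _:+_; _:*_; :-_; con)
  open import Relation.Binary.Reasoning.Setoid setoid

  Mat : ℕ → Set c
  Mat k = Fin k → Fin k → Carrier

  Det : ∀ {k} → Mat k → Carrier
  Det = det R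

  sgn : ∀ {k} → Fin k → Carrier
  sgn j = pow R (- 1#) (toℕ j)

  minor : ∀ {k} → Mat (suc k) → Fin (suc k) → Mat k
  minor M j r c = M (suc r) (punchIn j c)

  det-cong : ∀ {k} {M N : Mat k} → (∀ i j → M i j ≈ N i j) → Det M ≈ Det N
  det-cong {zero}  h = refl
  det-cong {suc k} h = Σ-cong (λ j → *-congˡ {sgn j} (*-cong (h zero j) (det-cong (λ r c → h (suc r) (punchIn j c)))))

  rowwise : ∀ {k} {M N : Mat k} (i : Fin k) → (∀ r → r ≢ i → ∀ c → N r c ≈ M r c) →
    (∀ c → N i c ≈ M i c) → ∀ r c → N r c ≈ M r c
  rowwise i off at r c with r ≟ i
  ... | yes ≡.refl = at c
  ... | no r≢i     = off r r≢i c

  term : ∀ {k} → Mat (suc k) → Fin (suc k) → Carrier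
  term M j = sgn j * (M zero j * Det (minor M j))

  expansion-linear : ∀ {k} (M N N′ : Mat (suc k)) (a b : Carrier) →
    (∀ j → term M j ≈ a * term N j + b * term N′ j) → Det M ≈ a * Det N + b * Det N′
  expansion-linear M N N′ a b h = begin
    Σ (term M)                                          ≈⟨ Σ-cong h ⟩
    Σ (λ j → a * term N j + b * term N′ j)              ≈⟨ Σ-+ (λ j → a * term N j) (λ j → b * term N′ j) ⟩
    Σ (λ j → a * term N j) + Σ (λ j → b * term N′ j)    ≈⟨ +-cong (Σ-*ˡ a (term N)) (Σ-*ˡ b (term N′)) ⟩
    a * Det N + b * Det N′                              ∎

  det-linear : ∀ {k} (M N N′ : Mat k) (i : Fin k) (a b : Carrier) →
    (∀ r → r ≢ i → ∀ c → M r c ≈ N r c) → (∀ r → r ≢ i → ∀ c → M r c ≈ N′ r c) →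
    (∀ c → M i c ≈ a * N i c + b * N′ i c) → Det M ≈ a * Det N + b * Det N′
  det-linear {suc k} M N N′ zero a b offN offN′ at = expansion-linear M N N′ a b (λ j → begin
    sgn j * (M zero j * Det (minor M j))                       ≈⟨ *-congˡ (*-congʳ (at j)) ⟩
    sgn j * ((a * N zero j + b * N′ zero j) * Det (minor M j))  ≈⟨ solve 6 (λ s a b x y d → s :* ((a :* x :+ b :* y) :* d)
                                                                       := a :* (s :* (x :* d)) :+ b :* (s :* (y :* d))) refl
                                                                       (sgn j) a b (N zero j) (N′ zero j) (Det (minor M j)) ⟩
    a * (sgn j * (N zero j * Det (minor M j))) + b * (sgn j * (N′ zero j * Det (minor M j)))
      ≈⟨ +-cong (*-congˡ (*-congˡ (*-congˡ (det-cong (λ r c → offN (suc r) (λ ()) (punchIn j c))))))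
                (*-congˡ (*-congˡ (*-congˡ (det-cong (λ r c → offN′ (suc r) (λ ()) (punchIn j c)))))) ⟩
    a * term N j + b * term N′ j                               ∎)
  det-linear {suc k} M N N′ (suc i) a b offN offN′ at = expansion-linear M N N′ a b (λ j → begin
    sgn j * (M zero j * Det (minor M j))
      ≈⟨ *-congˡ (*-congˡ (det-linear (minor M j) (minor N j) (minor N′ j) i a b
            (λ r r≢i c → offN (suc r) (r≢i ∘ FinP.suc-injective) (punchIn j c))
            (λ r r≢i c → offN′ (suc r) (r≢i ∘ FinP.suc-injective) (punchIn j c))
            (λ c → at (punchIn j c)))) ⟩
    sgn j * (M zero j * (a * Det (minor N j) + b * Det (minor N′ j)))
      ≈⟨ solve 6 (λ s a b x d e → s :* (x :* (a :* d :+ b :* e)) := a :* (s :* (x :* d)) :+ b :* (s :* (x :* e))) refl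
           (sgn j) a b (M zero j) (Det (minor N j)) (Det (minor N′ j)) ⟩
    a * (sgn j * (M zero j * Det (minor N j))) + b * (sgn j * (M zero j * Det (minor N′ j)))
      ≈⟨ +-cong (*-congˡ (*-congˡ (*-congʳ (offN zero (λ ()) j)))) (*-congˡ (*-congˡ (*-congʳ (offN′ zero (λ ()) j)))) ⟩
    a * term N j + b * term N′ j ∎)

  prod : ∀ {k} → (Fin k → Carrier) → Carrier
  prod {zero}  f = 1#
  prod {suc k} f = f zero * prod (f ∘ suc)

  prod-cong : ∀ {k} {f g : Fin k → Carrier} → (∀ i → f i ≈ g i) → prod f ≈ prod g
  prod-cong {zero}  h = refl
  prod-cong {suc k} h = *-cong (h zero) (prod-cong (h ∘ suc))

  prod-const : ∀ {k} (x : Carrier) → prod (λ (_ : Fin k) → x) ≈ pow R x k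
  prod-const {zero}  x = refl
  prod-const {suc k} x = *-congˡ (prod-const {k} x)

  prod-splitAt : ∀ a b (f : Fin (a ℕ.+ b) → Carrier) → prod f ≈ prod (λ i → f (i ↑ˡ b)) * prod (λ j → f (a ↑ʳ j))
  prod-splitAt zero    b f = sym (*-identityˡ _)
  prod-splitAt (suc a) b f = trans (*-congˡ (prod-splitAt a b (f ∘ suc))) (sym (*-assoc _ _ _))

  det-scale : ∀ {k} (M N : Mat k) (f : Fin k → Carrier) → (∀ r c → N r c ≈ f r * M r c) → Det N ≈ prod f * Det M
  det-scale {zero}  M N f h = sym (*-identityʳ _)
  det-scale {suc k} M N f h = trans (Σ-cong scaled) (Σ-*ˡ (f zero * prod (f ∘ suc)) (term M))
    where
    scaled : ∀ j → term N j ≈ (f zero * prod (f ∘ suc)) * term M j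
    scaled j = begin
      sgn j * (N zero j * Det (minor N j))
        ≈⟨ *-congˡ (*-cong (h zero j) (det-scale (minor M j) (minor N j) (f ∘ suc) (λ r c → h (suc r) (punchIn j c)))) ⟩
      sgn j * ((f zero * M zero j) * (prod (f ∘ suc) * Det (minor M j)))
        ≈⟨ solve 5 (λ s a x b d → s :* ((a :* x) :* (b :* d)) := (a :* b) :* (s :* (x :* d))) refl
             (sgn j) (f zero) (M zero j) (prod (f ∘ suc)) (Det (minor M j)) ⟩
      (f zero * prod (f ∘ suc)) * term M j ∎

  det-additive : ∀ {k} (A B C : Mat k) (i : Fin k) →
    (∀ r → r ≢ i → ∀ c → A r c ≈ B r c) → (∀ r → r ≢ i → ∀ c → A r c ≈ C r c) →
    (∀ c → A i c ≈ B i c + C i c) → Det A ≈ Det B + Det C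
  det-additive A B C i offB offC at =
    trans (det-linear A B C i 1# 1# offB offC (λ c → trans (at c) (+-cong (sym (*-identityˡ _)) (sym (*-identityˡ _)))))
          (+-cong (*-identityˡ _) (*-identityˡ _))

  replaceRow : ∀ {k} → Mat k → Fin k → (Fin k → Carrier) → Mat k
  replaceRow M i u r c = if does (r ≟ i) then u c else M r c

  replaceRow-here : ∀ {k} (M : Mat k) i u c → replaceRow M i u i c ≈ u c
  replaceRow-here M i u c = reflexive (if-yes (i ≟ i) ≡.refl)

  replaceRow-there : ∀ {k} (M : Mat k) i u r c → r ≢ i → replaceRow M i u r c ≈ M r c
  replaceRow-there M i u r c r≢i = reflexive (if-no (r ≟ i) r≢i)

  -- Alternation.  First: a matrix whose rows 0 and 1 agree has determinant 0,
  -- by expanding along both rows; the terms cancel in pairs because of the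
  -- following sign identity.
  sgn-punchOut : ∀ {n} (j k : Fin (suc n)) (j≢k : j ≢ k) (k≢j : k ≢ j) →
    sgn j * sgn (punchOut j≢k) ≈ - (sgn k * sgn (punchOut k≢j))
  sgn-punchOut zero zero j≢k k≢j = ⊥-elim (j≢k ≡.refl)
  sgn-punchOut {suc n} zero (suc k) j≢k k≢j =
    solve 1 (λ t → con ℤ1 :* t := :- ((:- con ℤ1 :* t) :* con ℤ1)) refl (sgn k)
  sgn-punchOut {suc n} (suc j) zero j≢k k≢j =
    solve 1 (λ t → (:- con ℤ1 :* t) :* con ℤ1 := :- (con ℤ1 :* t)) refl (sgn j)
  sgn-punchOut {suc n} (suc j) (suc k) j≢k k≢j = begin
    (- 1# * sgn j) * (- 1# * sgn (punchOut j≢k′))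
      ≈⟨ solve 2 (λ a b → (:- con ℤ1 :* a) :* (:- con ℤ1 :* b) := a :* b) refl (sgn j) (sgn (punchOut j≢k′)) ⟩
    sgn j * sgn (punchOut j≢k′)          ≈⟨ sgn-punchOut j k j≢k′ k≢j′ ⟩
    - (sgn k * sgn (punchOut k≢j′))
      ≈⟨ solve 2 (λ a b → :- (a :* b) := :- ((:- con ℤ1 :* a) :* (:- con ℤ1 :* b))) refl (sgn k) (sgn (punchOut k≢j′)) ⟩
    - ((- 1# * sgn k) * (- 1# * sgn (punchOut k≢j′))) ∎
    where
    j≢k′ : j ≢ k
    j≢k′ = j≢k ∘ ≡.cong suc
    k≢j′ : k ≢ j
    k≢j′ = k≢j ∘ ≡.cong suc

  det-rows01 : ∀ {k} (M : Mat (suc (suc k))) → (∀ c → M zero c ≈ M (suc zero) c) → Det M ≈ 0#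
  det-rows01 {k} M rows≈ = begin
    Det M                                    ≈⟨ Σ-cong expand ⟩
    Σ (λ j → Σ (λ l → pair j l (j ≟ l)))     ≈⟨ Σ-antisym (λ j l → pair j l (j ≟ l)) (λ j → pair-diag j (j ≟ j))
                                                         (λ j l → pair-anti j l (j ≟ l) (l ≟ j)) ⟩
    0#                                       ∎
    where
    a : Fin (suc (suc k)) → Carrier
    a = M zero
    rest : ∀ {j l : Fin (suc (suc k))} → j ≢ l → Carrier
    rest j≢l = Det (λ r c → M (suc (suc r)) (skipTwo j≢l c))
    -- the contribution of columns (j, l) to the double expansion
    pair : ∀ j l → Dec (j ≡ l) → Carrier
    pair j l (yes _)  = 0#
    pair j l (no j≢l) = (sgn j * sgn (punchOut j≢l)) * ((a j * a l) * rest j≢l)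
    pair-diag : ∀ j d → pair j j d ≈ 0#
    pair-diag j (yes _)  = refl
    pair-diag j (no j≢j) = ⊥-elim (j≢j ≡.refl)
    pair-anti : ∀ j l d d′ → pair j l d + pair l j d′ ≈ 0#
    pair-anti j l (yes _)   (yes _)   = +-identityˡ _
    pair-anti j l (yes j≡l) (no l≢j)  = ⊥-elim (l≢j (≡.sym j≡l))
    pair-anti j l (no j≢l)  (yes l≡j) = ⊥-elim (j≢l (≡.sym l≡j))
    pair-anti j l (no j≢l)  (no l≢j)  = begin
      (sgn j * sgn (punchOut j≢l)) * ((a j * a l) * rest j≢l) + (sgn l * sgn (punchOut l≢j)) * ((a l * a j) * rest l≢j)
        ≈⟨ +-cong (*-congʳ (sgn-punchOut j l j≢l l≢j))
                  (*-congˡ (*-congˡ (det-cong (λ r c → reflexive (≡.cong (M (suc (suc r))) (skipTwo-sym l j l≢j j≢l c)))))) ⟩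
      (- s) * ((a j * a l) * rest j≢l) + s * ((a l * a j) * rest j≢l)
        ≈⟨ solve 4 (λ s x y d → (:- s) :* ((x :* y) :* d) :+ s :* ((y :* x) :* d) := con ℤ0) refl s (a j) (a l) (rest j≢l) ⟩
      0# ∎
      where
      s : Carrier
      s = sgn l * sgn (punchOut l≢j)
    second-row : ∀ j l (d : Dec (j ≡ punchIn j l)) →
      sgn j * (a j * term (minor M j) l) ≈ pair j (punchIn j l) d
    second-row j l (yes j≡) = ⊥-elim (FinP.punchInᵢ≢i j l (≡.sym j≡))
    second-row j l (no j≢) = begin
      sgn j * (a j * (sgn l * (M (suc zero) (punchIn j l) * Det (minor (minor M j) l))))
        ≈⟨ solve 5 (λ s x t y d → s :* (x :* (t :* (y :* d))) := (s :* t) :* ((x :* y) :* d)) refl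
             (sgn j) (a j) (sgn l) (M (suc zero) (punchIn j l)) (Det (minor (minor M j) l)) ⟩
      (sgn j * sgn l) * ((a j * M (suc zero) (punchIn j l)) * Det (minor (minor M j) l))
        ≈⟨ *-cong (*-congˡ (reflexive (≡.cong sgn (≡.sym out-in))))
                  (*-cong (*-congˡ (sym (rows≈ (punchIn j l))))
                          (det-cong (λ r c → reflexive (≡.cong (λ t → M (suc (suc r)) (punchIn j (punchIn t c))) (≡.sym out-in))))) ⟩
      (sgn j * sgn (punchOut j≢)) * ((a j * a (punchIn j l)) * rest j≢) ∎
      where
      out-in : punchOut j≢ ≡ l
      out-in = ≡.trans (FinP.punchOut-cong j ≡.refl) (FinP.punchOut-punchIn j)
    expand : ∀ j → term M j ≈ Σ (λ l → pair j l (j ≟ l))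
    expand j = begin
      sgn j * (a j * Σ (term (minor M j)))       ≈⟨ *-congˡ (sym (Σ-*ˡ (a j) (term (minor M j)))) ⟩
      sgn j * Σ (λ l → a j * term (minor M j) l) ≈⟨ sym (Σ-*ˡ (sgn j) (λ l → a j * term (minor M j) l)) ⟩
      Σ (λ l → sgn j * (a j * term (minor M j) l)) ≈⟨ Σ-cong (λ l → second-row j l (j ≟ punchIn j l)) ⟩
      Σ (λ l → pair j (punchIn j l) (j ≟ punchIn j l))                 ≈⟨ sym (+-identityˡ _) ⟩
      0# + Σ (λ l → pair j (punchIn j l) (j ≟ punchIn j l))            ≈⟨ +-congʳ (sym (pair-diag j (j ≟ j))) ⟩
      pair j j (j ≟ j) + Σ (λ l → pair j (punchIn j l) (j ≟ punchIn j l)) ≈⟨ sym (Σ-punchIn j (λ l → pair j l (j ≟ l))) ⟩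
      Σ (λ l → pair j l (j ≟ l))                 ∎

  Alternating : ℕ → Set (c Level.⊔ ℓ)
  Alternating k = ∀ (M : Mat k) i j → i ≢ j → (∀ c → M i c ≈ M j c) → Det M ≈ 0#

  det-swap : ∀ {k} → Alternating k → ∀ (M N : Mat k) i j → i ≢ j →
    (∀ r → r ≢ i → r ≢ j → ∀ c → N r c ≈ M r c) →
    (∀ c → N i c ≈ M j c) → (∀ c → N j c ≈ M i c) → Det N ≈ - Det M
  det-swap {k} alt M N i j i≢j off N-i N-j = inverseʳ-unique (Det M) (Det N) (sym total)
    where
    j≢i : j ≢ i
    j≢i = i≢j ∘ ≡.sym
    W : (Fin k → Carrier) → (Fin k → Carrier) → Mat k
    W u v = replaceRow (replaceRow M j v) i u
    W-i : ∀ u v c → W u v i c ≈ u c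
    W-i u v = replaceRow-here (replaceRow M j v) i u
    W-j : ∀ u v c → W u v j c ≈ v c
    W-j u v c = trans (replaceRow-there (replaceRow M j v) i u j c j≢i) (replaceRow-here M j v c)
    W-not-i : ∀ u u′ v r → r ≢ i → ∀ c → W u v r c ≈ W u′ v r c
    W-not-i u u′ v r r≢i c = trans (replaceRow-there (replaceRow M j v) i u r c r≢i)
                                   (sym (replaceRow-there (replaceRow M j v) i u′ r c r≢i))
    W-not-j : ∀ u v v′ r → r ≢ j → ∀ c → W u v r c ≈ W u v′ r c
    W-not-j u v v′ r r≢j c =
      reflexive (≡.cong (λ y → if does (r ≟ i) then u c else y) (≡.trans (if-no (r ≟ j) r≢j) (≡.sym (if-no (r ≟ j) r≢j))))
    s : Fin k → Carrier
    s c = M i c + M j c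
    additive-i : ∀ v → Det (W s v) ≈ Det (W (M i) v) + Det (W (M j) v)
    additive-i v = det-additive _ _ _ i (W-not-i s (M i) v) (W-not-i s (M j) v)
      (λ c → trans (W-i s v c) (sym (+-cong (W-i (M i) v c) (W-i (M j) v c))))
    additive-j : ∀ u → Det (W u s) ≈ Det (W u (M i)) + Det (W u (M j))
    additive-j u = det-additive _ _ _ j (W-not-j u s (M i)) (W-not-j u s (M j))
      (λ c → trans (W-j u s c) (sym (+-cong (W-j u (M i) c) (W-j u (M j) c))))
    degenerate : ∀ u → Det (W u u) ≈ 0#
    degenerate u = alt (W u u) i j i≢j (λ c → trans (W-i u u c) (sym (W-j u u c)))
    W≈M : Det (W (M i) (M j)) ≈ Det M
    W≈M = det-cong (λ r c → restore r c (r ≟ i) (r ≟ j))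
      where
      restore : ∀ r c (d : Dec (r ≡ i)) (d′ : Dec (r ≡ j)) →
        (if does d then M i c else (if does d′ then M j c else M r c)) ≈ M r c
      restore r c (yes ≡.refl) d′         = refl
      restore r c (no _)       (yes ≡.refl) = refl
      restore r c (no _)       (no _)     = refl
    W≈N : Det (W (M j) (M i)) ≈ Det N
    W≈N = det-cong (λ r c → restore r c (r ≟ i) (r ≟ j))
      where
      restore : ∀ r c (d : Dec (r ≡ i)) (d′ : Dec (r ≡ j)) →
        (if does d then M j c else (if does d′ then M i c else M r c)) ≈ N r c
      restore r c (yes ≡.refl) d′           = sym (N-i c)
      restore r c (no _)       (yes ≡.refl) = sym (N-j c)
      restore r c (no r≢i)     (no r≢j)     = sym (off r r≢i r≢j c)
    total : 0# ≈ Det M + Det N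
    total = begin
      0#                                                                    ≈⟨ sym (degenerate s) ⟩
      Det (W s s)                                                           ≈⟨ additive-i s ⟩
      Det (W (M i) s) + Det (W (M j) s)                                     ≈⟨ +-cong (additive-j (M i)) (additive-j (M j)) ⟩
      (Det (W (M i) (M i)) + Det (W (M i) (M j))) + (Det (W (M j) (M i)) + Det (W (M j) (M j)))
        ≈⟨ +-cong (+-cong (degenerate (M i)) W≈M) (+-cong W≈N (degenerate (M j))) ⟩
      (0# + Det M) + (Det N + 0#)
        ≈⟨ solve 2 (λ a b → (con ℤ0 :+ a) :+ (b :+ con ℤ0) := a :+ b) refl (Det M) (Det N) ⟩
      Det M + Det N                                                         ∎

  -- Third: equal rows 0 and j+1.  For j > 0, swapping rows 1 and j+1 inside
  -- every minor reduces to det-rows01.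
  det-rows0 : ∀ k → Alternating k → (M : Mat (suc k)) (j : Fin k) → (∀ c → M zero c ≈ M (suc j) c) → Det M ≈ 0#
  det-rows0 (suc k) alt M zero    rows≈ = det-rows01 M rows≈
  det-rows0 (suc k) alt M (suc j) rows≈ = begin
    Det M          ≈⟨ solve 1 (λ a → a := :- (:- a)) refl (Det M) ⟩
    - (- Det M)    ≈⟨ -‿cong (sym swapped-neg) ⟩
    - Det M′       ≈⟨ -‿cong (det-rows01 M′ (λ c → trans (M′-off zero c (λ ()) (λ ())) (trans (rows≈ c) (sym (M′-1 c))))) ⟩
    - 0#           ≈⟨ solve 0 (:- con ℤ0 := con ℤ0) refl ⟩
    0#             ∎
    where
    one j+2 : Fin (suc (suc k))
    one = suc zero
    j+2 = suc (suc j)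
    j+2≢1 : j+2 ≢ one
    j+2≢1 = λ ()
    M′ : Mat (suc (suc k))
    M′ = replaceRow (replaceRow M j+2 (M one)) one (M j+2)
    M′-1 : ∀ c → M′ one c ≈ M j+2 c
    M′-1 = replaceRow-here (replaceRow M j+2 (M one)) one (M j+2)
    M′-j+2 : ∀ c → M′ j+2 c ≈ M one c
    M′-j+2 c = trans (replaceRow-there (replaceRow M j+2 (M one)) one (M j+2) j+2 c j+2≢1) (replaceRow-here M j+2 (M one) c)
    M′-off : ∀ r c → r ≢ one → r ≢ j+2 → M′ r c ≈ M r c
    M′-off r c r≢1 r≢j+2 = trans (replaceRow-there (replaceRow M j+2 (M one)) one (M j+2) r c r≢1)
                                 (replaceRow-there M j+2 (M one) r c r≢j+2)
    swapped-neg : Det M′ ≈ - Det M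
    swapped-neg = begin
      Σ (term M′)
        ≈⟨ Σ-cong (λ col → *-congˡ {sgn col} (*-cong (M′-off zero col (λ ()) (λ ()))
              (det-swap alt (minor M col) (minor M′ col) zero (suc j) (λ ())
                 (λ r r≢0 r≢j+1 c → M′-off (suc r) (punchIn col c) (r≢0 ∘ FinP.suc-injective) (r≢j+1 ∘ FinP.suc-injective))
                 (λ c → M′-1 (punchIn col c)) (λ c → M′-j+2 (punchIn col c))))) ⟩
      Σ (λ col → sgn col * (M zero col * - Det (minor M col)))
        ≈⟨ Σ-cong (λ col → solve 3 (λ s x d → s :* (x :* (:- d)) := :- (s :* (x :* d))) refl
                                  (sgn col) (M zero col) (Det (minor M col))) ⟩
      Σ (λ col → - term M col)  ≈⟨ Σ-neg (term M) ⟩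
      - Det M                   ∎

  det-alternating : ∀ k → Alternating k
  det-alternating zero    M () j i≢j rows≈
  det-alternating (suc k) M zero    zero    i≢j rows≈ = ⊥-elim (i≢j ≡.refl)
  det-alternating (suc k) M zero    (suc j) i≢j rows≈ = det-rows0 k (det-alternating k) M j rows≈
  det-alternating (suc k) M (suc i) zero    i≢j rows≈ = det-rows0 k (det-alternating k) M i (sym ∘ rows≈)
  det-alternating (suc k) M (suc i) (suc j) i≢j rows≈ = Σ-zero (λ col → begin
    sgn col * (M zero col * Det (minor M col))
      ≈⟨ *-congˡ (*-congˡ (det-alternating k (minor M col) i j (i≢j ∘ ≡.cong suc) (rows≈ ∘ punchIn col))) ⟩
    sgn col * (M zero col * 0#)  ≈⟨ solve 2 (λ s x → s :* (x :* con ℤ0) := con ℤ0) refl (sgn col) (M zero col) ⟩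
    0#                           ∎)

  det-rowAdd : ∀ {k} (M N : Mat k) i j → j ≢ i → (d : Carrier) → (∀ r → r ≢ i → ∀ c → N r c ≈ M r c) →
    (∀ c → N i c ≈ M i c + d * M j c) → Det N ≈ Det M
  det-rowAdd {k} M N i j j≢i d off at = begin
    Det N                   ≈⟨ det-linear N M W i 1# d off (λ r r≢i c → trans (off r r≢i c) (sym (replaceRow-there M i (M j) r c r≢i)))
                                 (λ c → trans (at c) (+-cong (sym (*-identityˡ _)) (*-congˡ (sym (replaceRow-here M i (M j) c))))) ⟩
    1# * Det M + d * Det W  ≈⟨ +-cong (*-identityˡ _) (*-congˡ (det-alternating k W i j (j≢i ∘ ≡.sym)
                                 (λ c → trans (replaceRow-here M i (M j) c) (sym (replaceRow-there M i (M j) j c j≢i))))) ⟩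
    Det M + d * 0#          ≈⟨ solve 2 (λ a d → a :+ d :* con ℤ0 := a) refl (Det M) d ⟩
    Det M                   ∎
    where
    W : Mat k
    W = replaceRow M i (M j)

  det-rowAddΣ : ∀ {k} s (M N : Mat k) (i : Fin k) (g : Fin s → Fin k) (C : Fin s → Carrier) →
    (∀ σ → g σ ≢ i ⊎ C σ ≈ 0#) → (∀ r → r ≢ i → ∀ c → N r c ≈ M r c) →
    (∀ c → N i c ≈ M i c + Σ (λ σ → C σ * M (g σ) c)) → Det N ≈ Det M
  det-rowAddΣ zero    M N i g C ok off at = det-cong (rowwise i off (λ c → trans (at c) (+-identityʳ _)))
  det-rowAddΣ {k} (suc s) M N i g C ok off at =
    trans first (det-rowAddΣ s M N₁ i (g ∘ suc) (C ∘ suc) (ok ∘ suc)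
                  (λ r r≢i c → replaceRow-there M i u r c r≢i) (replaceRow-here M i u))
    where
    u : Fin k → Carrier
    u c = M i c + Σ (λ σ → C (suc σ) * M (g (suc σ)) c)
    N₁ : Mat k
    N₁ = replaceRow M i u
    off₁ : ∀ r → r ≢ i → ∀ c → N r c ≈ N₁ r c
    off₁ r r≢i c = trans (off r r≢i c) (sym (replaceRow-there M i u r c r≢i))
    first : Det N ≈ Det N₁
    first with ok zero
    ... | inj₁ g0≢i = det-rowAdd N₁ N i (g zero) g0≢i (C zero) off₁ (λ c → begin
          N i c
            ≈⟨ at c ⟩
          M i c + (C zero * M (g zero) c + Σ (λ σ → C (suc σ) * M (g (suc σ)) c))
            ≈⟨ solve 3 (λ a b t → a :+ (b :+ t) := (a :+ t) :+ b) refl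
                 (M i c) (C zero * M (g zero) c) (Σ (λ σ → C (suc σ) * M (g (suc σ)) c)) ⟩
          u c + C zero * M (g zero) c
            ≈⟨ +-cong (sym (replaceRow-here M i u c)) (*-congˡ (sym (replaceRow-there M i u (g zero) c g0≢i))) ⟩
          N₁ i c + C zero * N₁ (g zero) c ∎)
    ... | inj₂ C0≈0 = det-cong (rowwise i off₁ (λ c → begin
          N i c
            ≈⟨ at c ⟩
          M i c + (C zero * M (g zero) c + Σ (λ σ → C (suc σ) * M (g (suc σ)) c))
            ≈⟨ +-congˡ (+-congʳ (*-congʳ C0≈0)) ⟩
          M i c + (0# * M (g zero) c + Σ (λ σ → C (suc σ) * M (g (suc σ)) c))
            ≈⟨ solve 3 (λ a b t → a :+ (con ℤ0 :* b :+ t) := a :+ t) refl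
                 (M i c) (M (g zero) c) (Σ (λ σ → C (suc σ) * M (g (suc σ)) c)) ⟩
          u c              ≈⟨ sym (replaceRow-here M i u c) ⟩
          N₁ i c           ∎))

  -- Rows are processed
  -- one at a time: Partial m has the new rows r < m and the old rows r ≥ m.
  det-rowAddAll : ∀ {k s} (M N : Mat k) (g : Fin s → Fin k) (C : Fin k → Fin s → Carrier) →
    (∀ r σ → g σ ≢ r ⊎ C r σ ≈ 0#) → (∀ σ c → N (g σ) c ≈ M (g σ) c) →
    (∀ r c → N r c ≈ M r c + Σ (λ σ → C r σ * M (g σ) c)) → Det N ≈ Det M
  det-rowAddAll {k} {s} M N g C ok sources-fixed at = begin
    Det N            ≈⟨ det-cong (λ r c → sym (reflexive (if-yes (toℕ r ℕP.<? k) (FinP.toℕ<n r)))) ⟩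
    Det (Partial k)  ≈⟨ all-steps k ⟩
    Det (Partial 0)  ≈⟨ det-cong (λ r c → reflexive (if-no (toℕ r ℕP.<? 0) {N r c} {M r c} (λ ()))) ⟩
    Det M            ∎
    where
    if-dec : ∀ {a} {A : Set a} (d : Dec A) {x y z : Carrier} → (A → x ≈ z) → (¬ A → y ≈ z) → (if does d then x else y) ≈ z
    if-dec (yes a) f g = f a
    if-dec (no ¬a) f g = g ¬a
    Partial : ℕ → Mat k
    Partial m r c = if does (toℕ r ℕP.<? m) then N r c else M r c
    source : ∀ m σ c → Partial m (g σ) c ≈ M (g σ) c
    source m σ c = if-dec (toℕ (g σ) ℕP.<? m) (λ _ → sources-fixed σ c) (λ _ → refl)
    step : ∀ m → Det (Partial (suc m)) ≈ Det (Partial m)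
    step m with m ℕP.<? k
    ... | no m≮k = det-cong (λ r c → trans (reflexive (if-yes (toℕ r ℕP.<? suc m) (ℕP.m<n⇒m<1+n (below r))))
                                            (sym (reflexive (if-yes (toℕ r ℕP.<? m) (below r)))))
      where
      below : ∀ r → toℕ r ℕ.< m
      below r = ℕP.<-≤-trans (FinP.toℕ<n r) (ℕP.≮⇒≥ m≮k)
    ... | yes m<k = det-rowAddΣ s (Partial m) (Partial (suc m)) rₘ g (C rₘ) (ok rₘ) off new
      where
      rₘ : Fin k
      rₘ = fromℕ< m<k
      toℕ-rₘ : toℕ rₘ ≡ m
      toℕ-rₘ = FinP.toℕ-fromℕ< m<k
      off : ∀ r → r ≢ rₘ → ∀ c → Partial (suc m) r c ≈ Partial m r c
      off r r≢rₘ c = if-dec (toℕ r ℕP.<? suc m)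
        (λ r<1+m → sym (reflexive (if-yes (toℕ r ℕP.<? m)
                     (ℕP.≤∧≢⇒< (ℕP.≤-pred r<1+m) (λ eq → r≢rₘ (FinP.toℕ-injective (≡.trans eq (≡.sym toℕ-rₘ))))))))
        (λ r≮1+m → sym (reflexive (if-no (toℕ r ℕP.<? m) (r≮1+m ∘ ℕP.m<n⇒m<1+n))))
      new : ∀ c → Partial (suc m) rₘ c ≈ Partial m rₘ c + Σ (λ σ → C rₘ σ * Partial m (g σ) c)
      new c = begin
        Partial (suc m) rₘ c
          ≈⟨ reflexive (if-yes (toℕ rₘ ℕP.<? suc m) (≡.subst (ℕ._< suc m) (≡.sym toℕ-rₘ) (ℕP.n<1+n m))) ⟩
        N rₘ c                ≈⟨ at rₘ c ⟩
        M rₘ c + Σ (λ σ → C rₘ σ * M (g σ) c)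
          ≈⟨ +-cong (sym (reflexive (if-no (toℕ rₘ ℕP.<? m) (ℕP.<-irrefl toℕ-rₘ))))
                    (Σ-cong (λ σ → *-congˡ (sym (source m σ c)))) ⟩
        Partial m rₘ c + Σ (λ σ → C rₘ σ * Partial m (g σ) c) ∎
    all-steps : ∀ m → Det (Partial m) ≈ Det (Partial 0)
    all-steps zero    = refl
    all-steps (suc m) = trans (step m) (all-steps m)

  det-column : ∀ {k} (M : Mat (suc k)) → Det M ≈ Σ (λ i → sgn i * (M i zero * Det (λ r c → M (punchIn i r) (suc c))))
  det-column {zero}  M = refl
  det-column {suc k} M = +-congˡ (begin
    Σ (λ j → sgn (suc j) * (M zero (suc j) * Det (minor M (suc j))))
      ≈⟨ Σ-cong (λ j → *-congˡ {sgn (suc j)} (*-congˡ {M zero (suc j)} (det-column (minor M (suc j))))) ⟩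
    Σ (λ j → sgn (suc j) * (M zero (suc j) * Σ (λ i → sgn i * (M (suc i) zero * D i j))))
      ≈⟨ Σ-cong (λ j → trans (*-congˡ {sgn (suc j)} (sym (Σ-*ˡ (M zero (suc j)) (λ i → sgn i * (M (suc i) zero * D i j)))))
                              (sym (Σ-*ˡ (sgn (suc j)) (λ i → M zero (suc j) * (sgn i * (M (suc i) zero * D i j)))))) ⟩
    Σ (λ j → Σ (λ i → sgn (suc j) * (M zero (suc j) * (sgn i * (M (suc i) zero * D i j)))))
      ≈⟨ Σ-swap (λ j i → sgn (suc j) * (M zero (suc j) * (sgn i * (M (suc i) zero * D i j)))) ⟩
    Σ (λ i → Σ (λ j → sgn (suc j) * (M zero (suc j) * (sgn i * (M (suc i) zero * D i j)))))
      ≈⟨ Σ-cong (λ i → Σ-cong (λ j → solve 5 (λ s a t b d → (:- con ℤ1 :* s) :* (a :* (t :* (b :* d)))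
                                                      := (:- con ℤ1 :* t) :* (b :* (s :* (a :* d)))) refl
                                                      (sgn j) (M zero (suc j)) (sgn i) (M (suc i) zero) (D i j))) ⟩
    Σ (λ i → Σ (λ j → sgn (suc i) * (M (suc i) zero * (sgn j * (M zero (suc j) * D i j)))))
      ≈⟨ Σ-cong (λ i → trans (Σ-*ˡ (sgn (suc i)) (λ j → M (suc i) zero * (sgn j * (M zero (suc j) * D i j))))
                              (*-congˡ {sgn (suc i)} (Σ-*ˡ (M (suc i) zero) (λ j → sgn j * (M zero (suc j) * D i j))))) ⟩
    Σ (λ i → sgn (suc i) * (M (suc i) zero * Σ (λ j → sgn j * (M zero (suc j) * D i j)))) ∎)
    where
    D : Fin (suc k) → Fin (suc k) → Carrier
    D i j = Det (λ r c → M (suc (punchIn i r)) (suc (punchIn j c)))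

  det-transpose : ∀ {k} (M : Mat k) → Det (λ i j → M j i) ≈ Det M
  det-transpose {zero}  M = refl
  det-transpose {suc k} M =
    trans (Σ-cong (λ j → *-congˡ {sgn j} (*-congˡ {M j zero} (det-transpose (λ r c → M (punchIn j r) (suc c))))))
          (sym (det-column M))

  det-block-lower : ∀ a b (M : Mat (a ℕ.+ b)) → (∀ i j → M (i ↑ˡ b) (a ↑ʳ j) ≈ 0#) →
    Det M ≈ Det (λ i j → M (i ↑ˡ b) (j ↑ˡ b)) * Det (λ i j → M (a ↑ʳ i) (a ↑ʳ j))
  det-block-lower zero    b M upper-right = sym (*-identityˡ _)
  det-block-lower (suc a) b M upper-right = begin
    Σ (term M)
      ≈⟨ Σ-splitAt (suc a) b (term M) ⟩
    Σ (λ i → term M (i ↑ˡ b)) + Σ (λ j → term M (suc a ↑ʳ j))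
      ≈⟨ +-cong (Σ-cong left-column) (Σ-zero (λ j → trans (*-congˡ {sgn (suc a ↑ʳ j)} (*-congʳ (upper-right zero j)))
                  (solve 2 (λ s d → s :* (con ℤ0 :* d) := con ℤ0) refl (sgn (suc a ↑ʳ j)) (Det (minor M (suc a ↑ʳ j)))))) ⟩
    Σ (λ i → term X i * Det Z) + 0#  ≈⟨ +-identityʳ _ ⟩
    Σ (λ i → term X i * Det Z)       ≈⟨ Σ-*ʳ (Det Z) (term X) ⟩
    Det X * Det Z                    ∎
    where
    X : Mat (suc a)
    X i j = M (i ↑ˡ b) (j ↑ˡ b)
    Z : Mat b
    Z i j = M (suc a ↑ʳ i) (suc a ↑ʳ j)
    left-column : ∀ i → term M (i ↑ˡ b) ≈ term X i * Det Z
    left-column i = begin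
      sgn (i ↑ˡ b) * (M zero (i ↑ˡ b) * Det (minor M (i ↑ˡ b)))
        ≈⟨ *-cong (reflexive (≡.cong (pow R (- 1#)) (FinP.toℕ-↑ˡ i b)))
                  (*-congˡ (det-block-lower a b (minor M (i ↑ˡ b))
                     (λ r j → trans (reflexive (≡.cong (M (suc (r ↑ˡ b))) (punchIn-↑ʳ b i j))) (upper-right (suc r) j)))) ⟩
      sgn i * (X zero i * (Det (λ r c → minor M (i ↑ˡ b) (r ↑ˡ b) (c ↑ˡ b))
                           * Det (λ r c → minor M (i ↑ˡ b) (a ↑ʳ r) (a ↑ʳ c))))
        ≈⟨ *-congˡ {sgn i} (*-congˡ (*-cong (det-cong (λ r c → reflexive (≡.cong (M (suc (r ↑ˡ b))) (punchIn-↑ˡ b i c))))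
                                             (det-cong (λ r c → reflexive (≡.cong (M (suc (a ↑ʳ r))) (punchIn-↑ʳ b i c)))))) ⟩
      sgn i * (X zero i * (Det (minor X i) * Det Z))
        ≈⟨ solve 4 (λ s x d z → s :* (x :* (d :* z)) := (s :* (x :* d)) :* z) refl (sgn i) (X zero i) (Det (minor X i)) (Det Z) ⟩
      term X i * Det Z ∎

  det-block-upper : ∀ a b (M : Mat (a ℕ.+ b)) → (∀ i j → M (a ↑ʳ i) (j ↑ˡ b) ≈ 0#) →
    Det M ≈ Det (λ i j → M (i ↑ˡ b) (j ↑ˡ b)) * Det (λ i j → M (a ↑ʳ i) (a ↑ʳ j))
  det-block-upper a b M lower-left = begin
    Det M                   ≈⟨ sym (det-transpose M) ⟩
    Det (λ i j → M j i)     ≈⟨ det-block-lower a b (λ i j → M j i) (λ i j → lower-left j i) ⟩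
    Det (λ i j → M (j ↑ˡ b) (i ↑ˡ b)) * Det (λ i j → M (a ↑ʳ j) (a ↑ʳ i))
      ≈⟨ *-cong (det-transpose (λ i j → M (i ↑ˡ b) (j ↑ˡ b))) (det-transpose (λ i j → M (a ↑ʳ i) (a ↑ʳ j))) ⟩
    Det (λ i j → M (i ↑ˡ b) (j ↑ˡ b)) * Det (λ i j → M (a ↑ʳ i) (a ↑ʳ j)) ∎

  det-cast : ∀ {a b} (eq : a ≡ b) (M : Mat b) → Det (λ i j → M (cast eq i) (cast eq j)) ≈ Det M
  det-cast ≡.refl M = det-cong (λ i j → reflexive (≡.cong₂ M (FinP.cast-is-id ≡.refl i) (FinP.cast-is-id ≡.refl j)))

  det-pivot : ∀ {k} (M : Mat (suc k)) → (∀ j → j ≢ zero → M zero j ≈ 0#) → Det M ≈ M zero zero * Det (minor M zero)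
  det-pivot M row0 = trans (Σ-single zero (term M) (λ j j≢0 → trans (*-congˡ {sgn j} (*-congʳ (row0 j j≢0)))
                                (solve 2 (λ s d → s :* (con ℤ0 :* d) := con ℤ0) refl (sgn j) (Det (minor M j)))))
                           (*-identityˡ _)

  det-identity : ∀ {k} → Det (λ (i j : Fin k) → δ R i j) ≈ 1#
  det-identity {zero}  = refl
  det-identity {suc k} = begin
    Det (λ (i j : Fin (suc k)) → δ R i j)
      ≈⟨ det-pivot {k} (λ i j → δ R i j) (λ { zero 0≢0 → ⊥-elim (0≢0 ≡.refl) ; (suc j) _ → refl }) ⟩
    1# * Det (λ (i j : Fin k) → δ R (suc i) (suc j)) ≈⟨ *-identityˡ _ ⟩
    Det (λ (i j : Fin k) → δ R (suc i) (suc j)) ≈⟨ det-cong {k} δ-suc ⟩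
    Det (λ (i j : Fin k) → δ R i j)            ≈⟨ det-identity {k} ⟩
    1#                                         ∎

  det-scalar : ∀ {k} (x : Carrier) (M : Mat k) → (∀ i j → M i j ≈ x * δ R i j) → Det M ≈ pow R x k
  det-scalar {k} x M h = begin
    Det M                                            ≈⟨ det-scale {k} (λ i j → δ R i j) M (λ _ → x) h ⟩
    prod (λ (_ : Fin k) → x) * Det (λ (i j : Fin k) → δ R i j) ≈⟨ *-cong (prod-const {k} x) (det-identity {k}) ⟩
    pow R x k * 1#                                   ≈⟨ *-identityʳ _ ⟩
    pow R x k                                        ∎

-- Matrices indexed by a finite type.  An enumeration of a type by Fin k lets
-- matrix entries be defined by cases on, e.g., V ⊎ E.
record Enumeration (k : ℕ) : Set₁ where
  field
    Index         : Set
    encode        : Index → Fin k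
    decode        : Fin k → Index
    encode-decode : ∀ r → encode (decode r) ≡ r
    decode-encode : ∀ t → decode (encode t) ≡ t

open Enumeration

finEnum : ∀ k → Enumeration k
finEnum k = record { Index = Fin k ; encode = id ; decode = id ; encode-decode = λ _ → ≡.refl ; decode-encode = λ _ → ≡.refl }

_⊎ₑ_ : ∀ {a b} → Enumeration a → Enumeration b → Enumeration (a ℕ.+ b)
_⊎ₑ_ {a} {b} I J = record
  { Index = Index I ⊎ Index J ; encode = enc ; decode = dec ; encode-decode = enc-dec ; decode-encode = dec-enc }
  where
  enc : Index I ⊎ Index J → Fin (a ℕ.+ b)
  enc (inj₁ t) = encode I t ↑ˡ b
  enc (inj₂ t) = a ↑ʳ encode J t
  dec : Fin (a ℕ.+ b) → Index I ⊎ Index J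
  dec r = Sum.map (decode I) (decode J) (splitAt a r)
  enc-map : ∀ s → enc (Sum.map (decode I) (decode J) s) ≡ join a b s
  enc-map (inj₁ i) = ≡.cong (_↑ˡ b) (encode-decode I i)
  enc-map (inj₂ j) = ≡.cong (a ↑ʳ_) (encode-decode J j)
  enc-dec : ∀ r → enc (dec r) ≡ r
  enc-dec r = ≡.trans (enc-map (splitAt a r)) (FinP.join-splitAt a b r)
  dec-enc : ∀ t → dec (enc t) ≡ t
  dec-enc (inj₁ t) = ≡.trans (≡.cong (Sum.map (decode I) (decode J)) (FinP.splitAt-↑ˡ a (encode I t) b))
                             (≡.cong inj₁ (decode-encode I t))
  dec-enc (inj₂ t) = ≡.trans (≡.cong (Sum.map (decode I) (decode J)) (FinP.splitAt-↑ʳ a b (encode J t)))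
                             (≡.cong inj₂ (decode-encode J t))

infixr 4 _⊎ₑ_

⊎-assoc : ∀ {A B C : Set} → (A ⊎ B) ⊎ C → A ⊎ (B ⊎ C)
⊎-assoc (inj₁ (inj₁ a)) = inj₁ a
⊎-assoc (inj₁ (inj₂ b)) = inj₂ (inj₁ b)
⊎-assoc (inj₂ c)        = inj₂ (inj₂ c)

module EnumeratedMatrices {c ℓ : Level} (R : CommutativeRing c ℓ) where
  open CommutativeRing R hiding (zero)
  open FinSums R
  open Determinants R
  open import Relation.Binary.Reasoning.Setoid setoid

  matrix : ∀ {k} (I : Enumeration k) → (Index I → Index I → Carrier) → Mat k
  matrix I F r c = F (decode I r) (decode I c)

  encode-injective : ∀ {k} (I : Enumeration k) {t u} → t ≢ u → encode I t ≢ encode I u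
  encode-injective I {t} {u} t≢u eq = t≢u (≡.trans (≡.sym (decode-encode I t)) (≡.trans (≡.cong (decode I) eq) (decode-encode I u)))

  det-congₑ : ∀ {k} (I : Enumeration k) (F G : Index I → Index I → Carrier) → (∀ t u → F t u ≈ G t u) →
    Det (matrix I F) ≈ Det (matrix I G)
  det-congₑ I F G h = det-cong (λ r c → h (decode I r) (decode I c))

  det-scaleₑ : ∀ {k} (I : Enumeration k) (F G : Index I → Index I → Carrier) (f : Index I → Carrier) →
    (∀ t u → G t u ≈ f t * F t u) → Det (matrix I G) ≈ prod (f ∘ decode I) * Det (matrix I F)
  det-scaleₑ I F G f h = det-scale (matrix I F) (matrix I G) (f ∘ decode I) (λ r c → h (decode I r) (decode I c))

  det-rowAddAllₑ : ∀ {k} (I : Enumeration k) (F G : Index I → Index I → Carrier) {s} (g : Fin s → Index I)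
    (C : Index I → Fin s → Carrier) → (∀ t σ → g σ ≢ t ⊎ C t σ ≈ 0#) → (∀ σ u → G (g σ) u ≈ F (g σ) u) →
    (∀ t u → G t u ≈ F t u + Σ (λ σ → C t σ * F (g σ) u)) → Det (matrix I G) ≈ Det (matrix I F)
  det-rowAddAllₑ I F G g C ok sources-fixed at =
    det-rowAddAll (matrix I F) (matrix I G) (encode I ∘ g) (λ r σ → C (decode I r) σ) ok′ sources-fixed′ at′
    where
    decode-g : ∀ σ → decode I (encode I (g σ)) ≡ g σ
    decode-g σ = decode-encode I (g σ)
    ok′ : ∀ r σ → encode I (g σ) ≢ r ⊎ C (decode I r) σ ≈ 0#
    ok′ r σ with ok (decode I r) σ
    ... | inj₁ g≢ = inj₁ (λ eq → encode-injective I g≢ (≡.trans eq (≡.sym (encode-decode I r))))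
    ... | inj₂ C≈0 = inj₂ C≈0
    sources-fixed′ : ∀ σ c → matrix I G (encode I (g σ)) c ≈ matrix I F (encode I (g σ)) c
    sources-fixed′ σ c = trans (reflexive (≡.cong (λ t → G t (decode I c)) (decode-g σ)))
                           (trans (sources-fixed σ (decode I c)) (reflexive (≡.cong (λ t → F t (decode I c)) (≡.sym (decode-g σ)))))
    at′ : ∀ r c → matrix I G r c ≈ matrix I F r c + Σ (λ σ → C (decode I r) σ * matrix I F (encode I (g σ)) c)
    at′ r c = trans (at (decode I r) (decode I c))
                    (+-congˡ (Σ-cong (λ σ → *-congˡ (reflexive (≡.cong (λ t → F t (decode I c)) (≡.sym (decode-g σ)))))))

  prod-⊎ : ∀ {a b} (I : Enumeration a) (J : Enumeration b) (f : Index (I ⊎ₑ J) → Carrier) →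
    prod (f ∘ decode (I ⊎ₑ J)) ≈ prod (λ i → f (inj₁ (decode I i))) * prod (λ j → f (inj₂ (decode J j)))
  prod-⊎ {a} {b} I J f = trans (prod-splitAt a b _)
    (*-cong (prod-cong (λ i → reflexive (≡.cong (f ∘ Sum.map (decode I) (decode J)) (FinP.splitAt-↑ˡ a i b))))
            (prod-cong (λ j → reflexive (≡.cong (f ∘ Sum.map (decode I) (decode J)) (FinP.splitAt-↑ʳ a b j)))))

  private
    block : ∀ {a b} (I : Enumeration a) (J : Enumeration b) (F : Index (I ⊎ₑ J) → Index (I ⊎ₑ J) → Carrier) →
      ∀ {r c s t} → splitAt a r ≡ s → splitAt a c ≡ t →
      matrix (I ⊎ₑ J) F r c ≈ F (Sum.map (decode I) (decode J) s) (Sum.map (decode I) (decode J) t)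
    block I J F eq eq′ = reflexive (≡.cong₂ (λ s t → F (Sum.map (decode I) (decode J) s) (Sum.map (decode I) (decode J) t)) eq eq′)

  det-block-lowerₑ : ∀ {a b} (I : Enumeration a) (J : Enumeration b) (F : Index (I ⊎ₑ J) → Index (I ⊎ₑ J) → Carrier) →
    (∀ t u → F (inj₁ t) (inj₂ u) ≈ 0#) →
    Det (matrix (I ⊎ₑ J) F) ≈ Det (matrix I (λ t u → F (inj₁ t) (inj₁ u))) * Det (matrix J (λ t u → F (inj₂ t) (inj₂ u)))
  det-block-lowerₑ {a} {b} I J F zero-block =
    trans (det-block-lower a b (matrix (I ⊎ₑ J) F)
             (λ i j → trans (block I J F (FinP.splitAt-↑ˡ a i b) (FinP.splitAt-↑ʳ a b j)) (zero-block _ _)))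
          (*-cong (det-cong (λ i j → block I J F (FinP.splitAt-↑ˡ a i b) (FinP.splitAt-↑ˡ a j b)))
                  (det-cong (λ i j → block I J F (FinP.splitAt-↑ʳ a b i) (FinP.splitAt-↑ʳ a b j))))

  det-block-upperₑ : ∀ {a b} (I : Enumeration a) (J : Enumeration b) (F : Index (I ⊎ₑ J) → Index (I ⊎ₑ J) → Carrier) →
    (∀ t u → F (inj₂ t) (inj₁ u) ≈ 0#) →
    Det (matrix (I ⊎ₑ J) F) ≈ Det (matrix I (λ t u → F (inj₁ t) (inj₁ u))) * Det (matrix J (λ t u → F (inj₂ t) (inj₂ u)))
  det-block-upperₑ {a} {b} I J F zero-block =
    trans (det-block-upper a b (matrix (I ⊎ₑ J) F)
             (λ i j → trans (block I J F (FinP.splitAt-↑ʳ a b i) (FinP.splitAt-↑ˡ a j b)) (zero-block _ _)))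
          (*-cong (det-cong (λ i j → block I J F (FinP.splitAt-↑ˡ a i b) (FinP.splitAt-↑ˡ a j b)))
                  (det-cong (λ i j → block I J F (FinP.splitAt-↑ʳ a b i) (FinP.splitAt-↑ʳ a b j))))

  det-⊎-assoc : ∀ a b c′ (F : Fin a ⊎ (Fin b ⊎ Fin c′) → Fin a ⊎ (Fin b ⊎ Fin c′) → Carrier) →
    Det (matrix (finEnum a ⊎ₑ finEnum b ⊎ₑ finEnum c′) F) ≈
    Det (matrix ((finEnum a ⊎ₑ finEnum b) ⊎ₑ finEnum c′) (λ t u → F (⊎-assoc t) (⊎-assoc u)))
  det-⊎-assoc a b c′ F = sym (trans (det-cong entries) (det-cast (ℕP.+-assoc a b c′) (matrix I₁ F)))
    where
    I₁ : Enumeration (a ℕ.+ (b ℕ.+ c′))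
    I₁ = finEnum a ⊎ₑ finEnum b ⊎ₑ finEnum c′
    I₂ : Enumeration ((a ℕ.+ b) ℕ.+ c′)
    I₂ = (finEnum a ⊎ₑ finEnum b) ⊎ₑ finEnum c′
    eq : (a ℕ.+ b) ℕ.+ c′ ≡ a ℕ.+ (b ℕ.+ c′)
    eq = ℕP.+-assoc a b c′
    cast-encode : ∀ t → cast eq (encode I₂ t) ≡ encode I₁ (⊎-assoc t)
    cast-encode (inj₁ (inj₁ i)) = FinP.toℕ-injective (≡.trans (FinP.toℕ-cast eq _)
      (≡.trans (FinP.toℕ-↑ˡ (i ↑ˡ b) c′) (≡.trans (FinP.toℕ-↑ˡ i b) (≡.sym (FinP.toℕ-↑ˡ i (b ℕ.+ c′))))))
    cast-encode (inj₁ (inj₂ j)) = FinP.toℕ-injective (≡.trans (FinP.toℕ-cast eq _)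
      (≡.trans (FinP.toℕ-↑ˡ (a ↑ʳ j) c′) (≡.trans (FinP.toℕ-↑ʳ a j)
        (≡.sym (≡.trans (FinP.toℕ-↑ʳ a (j ↑ˡ c′)) (≡.cong (a ℕ.+_) (FinP.toℕ-↑ˡ j c′)))))))
    cast-encode (inj₂ k) = FinP.toℕ-injective (≡.trans (FinP.toℕ-cast eq _)
      (≡.trans (FinP.toℕ-↑ʳ (a ℕ.+ b) k) (≡.trans (ℕP.+-assoc a b (toℕ k))
        (≡.sym (≡.trans (FinP.toℕ-↑ʳ a (b ↑ʳ k)) (≡.cong (a ℕ.+_) (FinP.toℕ-↑ʳ b k)))))))
    decode-cast : ∀ i → ⊎-assoc (decode I₂ i) ≡ decode I₁ (cast eq i)
    decode-cast i = ≡.trans (≡.sym (decode-encode I₁ (⊎-assoc (decode I₂ i))))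
      (≡.cong (decode I₁) (≡.trans (≡.sym (cast-encode (decode I₂ i))) (≡.cong (cast eq) (encode-decode I₂ i))))
    entries : ∀ i j → matrix I₂ (λ t u → F (⊎-assoc t) (⊎-assoc u)) i j ≈ matrix I₁ F (cast eq i) (cast eq j)
    entries i j = reflexive (≡.cong₂ F (decode-cast i) (decode-cast j))

↑ˡ≢↑ʳ : ∀ {n m} (a : Fin n) (b : Fin m) → a ↑ˡ m ≢ n ↑ʳ b
↑ˡ≢↑ʳ {n} {m} a b eq with ≡.trans (≡.sym (FinP.splitAt-↑ˡ n a m)) (≡.trans (≡.cong (splitAt n) eq) (FinP.splitAt-↑ʳ n m b))
... | ()

module Adjacency {c ℓ : Level} (R : CommutativeRing c ℓ) {n m : ℕ} (ψ : Fin m → Fin n × Fin n) where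
  open CommutativeRing R hiding (zero)
  open FinSums R
  open IntegerSolver R using (ℕ→R-+)
  open import Relation.Binary.Reasoning.Setoid setoid

  D : Digraph
  D = record { nV = n ; nE = m ; ψ = ψ }

  T H : Fin m → Fin n → Carrier
  T e u = δ R (tl D e) u
  H e u = δ R (hd D e) u

  adj-D : ∀ u w → ℕ→R R (adj D u w) ≈ Σ (λ e → T e u * H e w)
  adj-D u w = trans (count-Σ (λ e → ⌊ tl D e ≟ u ⌋ ∧ ⌊ hd D e ≟ w ⌋))
                    (Σ-cong (λ e → [∧] ⌊ tl D e ≟ u ⌋ ⌊ hd D e ≟ w ⌋))

  T-row : ∀ e → Σ (λ u → T e u) ≈ 1#
  T-row e = trans (Σ-cong (δ-sym (tl D e))) (Σ-δ-1 (tl D e))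

  -- (H Tᵀ)(e, q) = [h e = t q], the adjacency matrix of the line digraph
  H·Tᵀ : ∀ e q → Σ (λ u → H e u * T q u) ≈ δ R (hd D e) (tl D q)
  H·Tᵀ e q = begin
    Σ (λ u → H e u * T q u)            ≈⟨ Σ-cong (λ u → *-congʳ {T q u} (δ-sym (hd D e) u)) ⟩
    Σ (λ u → δ R u (hd D e) * T q u)   ≈⟨ Σ-δ (hd D e) (T q) ⟩
    δ R (tl D q) (hd D e)              ≈⟨ δ-sym (tl D q) (hd D e) ⟩
    δ R (hd D e) (tl D q)              ∎

  V′ : Fin n → Fin (n ℕ.+ m)
  V′ v = v ↑ˡ m
  E′ : Fin m → Fin (n ℕ.+ m)
  E′ e = n ↑ʳ e

  listCount : ∀ {X : Set} → (X → Bool) → List X → Carrier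
  listCount f []      = 0#
  listCount f (a ∷ L) = [ f a ] + listCount f L

  count-lookup : ∀ {X : Set} (f : X → Bool) (L : List X) → ℕ→R R (count {length L} (f ∘ lookup L)) ≈ listCount f L
  count-lookup f []      = refl
  count-lookup f (a ∷ L) = trans (ℕ→R-+ (if f a then 1 else 0) _) (+-cong (one-or-zero (f a)) (count-lookup f L))

  listCount-++ : ∀ {X : Set} (f : X → Bool) (L L′ : List X) → listCount f (L ++ L′) ≈ listCount f L + listCount f L′
  listCount-++ f []      L′ = sym (+-identityˡ _)
  listCount-++ f (a ∷ L) L′ = trans (+-congˡ (listCount-++ f L L′)) (sym (+-assoc _ _ _))

  listCount-concatMap : ∀ {X : Set} {k} (f : X → Bool) (g : Fin k → List X) →
    listCount f (concatMap g (allFin k)) ≈ Σ (λ a → listCount f (g a))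
  listCount-concatMap f g = go _ g id
    where
    go : ∀ k {j} (g : Fin j → List _) (h : Fin k → Fin j) → listCount f (concatMap g (tabulate h)) ≈ Σ (λ a → listCount f (g (h a)))
    go zero    g h = refl
    go (suc k) g h = trans (listCount-++ f (g (h zero)) _) (+-congˡ (go k g (h ∘ suc)))

  pairSum : ∀ {a b k} → (Fin a → Fin b → Carrier) → (Fin a → Fin k) → (Fin b → Fin k) → Fin k → Fin k → Carrier
  pairSum w f g i j = Σ (λ p → Σ (λ q → w p q * (δ R (f p) i * δ R (g q) j)))

  pairSum-hit : ∀ {a b k} (w : Fin a → Fin b → Carrier) (f : Fin a → Fin k) (g : Fin b → Fin k) →
    (∀ x y → f x ≡ f y → x ≡ y) → (∀ x y → g x ≡ g y → x ≡ y) → ∀ x y → pairSum w f g (f x) (g y) ≈ w x y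
  pairSum-hit w f g f-inj g-inj x y = begin
    Σ (λ p → Σ (λ q → w p q * (δ R (f p) (f x) * δ R (g q) (g y))))
      ≈⟨ Σ-cong (λ p → Σ-cong (λ q → trans (*-congˡ (*-cong (reflexive (δ-injective f f-inj p x))
                                                             (reflexive (δ-injective g g-inj q y))))
                                            (rearrange (w p q) (δ R p x) (δ R q y)))) ⟩
    Σ (λ p → Σ (λ q → δ R p x * (δ R q y * w p q)))  ≈⟨ Σ-cong (λ p → Σ-*ˡ (δ R p x) (λ q → δ R q y * w p q)) ⟩
    Σ (λ p → δ R p x * Σ (λ q → δ R q y * w p q))    ≈⟨ Σ-cong (λ p → *-congˡ (Σ-δ y (w p))) ⟩
    Σ (λ p → δ R p x * w p y)                        ≈⟨ Σ-δ x (λ p → w p y) ⟩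
    w x y                                            ∎
    where
    rearrange : ∀ u a b → u * (a * b) ≈ a * (b * u)
    rearrange u a b = trans (*-comm u (a * b)) (*-assoc a b u)

  pairSum-missˡ : ∀ {a b k} (w : Fin a → Fin b → Carrier) (f : Fin a → Fin k) (g : Fin b → Fin k) {i} j →
    (∀ p → f p ≢ i) → pairSum w f g i j ≈ 0#
  pairSum-missˡ {a} {b} w f g {i} j miss = Σ-zero {a} (λ p → Σ-zero {b} (λ q →
    trans (*-congˡ {w p q} (trans (*-congʳ (reflexive (δ-apart (miss p)))) (zeroˡ (δ R (g q) j)))) (zeroʳ (w p q))))

  pairSum-missʳ : ∀ {a b k} (w : Fin a → Fin b → Carrier) (f : Fin a → Fin k) (g : Fin b → Fin k) i {j} →
    (∀ q → g q ≢ j) → pairSum w f g i j ≈ 0#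
  pairSum-missʳ {a} {b} w f g i {j} miss = Σ-zero {a} (λ p → Σ-zero {b} (λ q →
    trans (*-congˡ {w p q} (trans (*-congˡ (reflexive (δ-apart (miss q)))) (zeroʳ (δ R (f p) i)))) (zeroʳ (w p q))))

  lineArc : Fin m → Fin m → Carrier
  lineArc p q = δ R (hd D p) (tl D q)

  adj-D01 : ∀ i j → ℕ→R R (adj (D01 D) i j) ≈
    pairSum lineArc E′ E′ i j + (pairSum (λ _ _ → 1#) V′ E′ i j + pairSum (λ _ _ → 1#) E′ V′ i j)
  adj-D01 i j = begin
    ℕ→R R (adj (D01 D) i j)
      ≈⟨ count-lookup (arc? i j) (lineArcs ++ (veArcs ++ evArcs)) ⟩
    listCount (arc? i j) (lineArcs ++ (veArcs ++ evArcs))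
      ≈⟨ trans (listCount-++ (arc? i j) lineArcs _) (+-congˡ (listCount-++ (arc? i j) veArcs evArcs)) ⟩
    listCount (arc? i j) lineArcs + (listCount (arc? i j) veArcs + listCount (arc? i j) evArcs)
      ≈⟨ +-cong (double (λ p q → lineArc-count p q (tl D q))) (+-cong (double (λ v e → single (V′ v) (E′ e)))
                (trans (double (λ v e → single (E′ e) (V′ v))) (Σ-swap (λ v e → δ R (E′ e) i * δ R (V′ v) j)))) ⟩
    pairSum lineArc E′ E′ i j + (Σ (λ v → Σ (λ e → δ R (V′ v) i * δ R (E′ e) j))
                               + Σ (λ e → Σ (λ v → δ R (E′ e) i * δ R (V′ v) j)))
      ≈⟨ +-congˡ (+-cong (Σ-cong (λ v → Σ-cong {m} (λ e → sym (*-identityˡ (δ R (V′ v) i * δ R (E′ e) j)))))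
                        (Σ-cong (λ e → Σ-cong {n} (λ v → sym (*-identityˡ (δ R (E′ e) i * δ R (V′ v) j)))))) ⟩
    pairSum lineArc E′ E′ i j + (pairSum (λ _ _ → 1#) V′ E′ i j + pairSum (λ _ _ → 1#) E′ V′ i j) ∎
    where
    Arcs : Set
    Arcs = List (Fin (n ℕ.+ m) × Fin (n ℕ.+ m))
    lineArcs veArcs evArcs : Arcs
    lineArcs = concatMap (λ p → concatMap (λ q → if ⌊ hd D p ≟ tl D q ⌋ then (E′ p , E′ q) ∷ [] else []) (allFin m)) (allFin m)
    veArcs   = concatMap (λ v → concatMap (λ e → (V′ v , E′ e) ∷ []) (allFin m)) (allFin n)
    evArcs   = concatMap (λ v → concatMap (λ e → (E′ e , V′ v) ∷ []) (allFin m)) (allFin n)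
    arc? : Fin (n ℕ.+ m) → Fin (n ℕ.+ m) → Fin (n ℕ.+ m) × Fin (n ℕ.+ m) → Bool
    arc? i j (s , t) = ⌊ s ≟ i ⌋ ∧ ⌊ t ≟ j ⌋
    single : ∀ s t → listCount (arc? i j) ((s , t) ∷ []) ≈ δ R s i * δ R t j
    single s t = trans (+-identityʳ _) ([∧] ⌊ s ≟ i ⌋ ⌊ t ≟ j ⌋)
    lineArc-count : ∀ p q u → listCount (arc? i j) (if ⌊ hd D p ≟ u ⌋ then (E′ p , E′ q) ∷ [] else [])
                              ≈ δ R (hd D p) u * (δ R (E′ p) i * δ R (E′ q) j)
    lineArc-count p q u with hd D p ≟ u
    ... | yes _ = trans (single (E′ p) (E′ q)) (sym (*-identityˡ _))
    ... | no _  = sym (zeroˡ _)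
    double : ∀ {a b} {L : Fin a → Fin b → Arcs} {w : Fin a → Fin b → Carrier} →
      (∀ x y → listCount (arc? i j) (L x y) ≈ w x y) →
      listCount (arc? i j) (concatMap (λ x → concatMap (L x) (allFin b)) (allFin a)) ≈ Σ (λ x → Σ (w x))
    double {L = L} h = trans (listCount-concatMap (arc? i j) (λ x → concatMap (L x) (allFin _)))
                             (Σ-cong (λ x → trans (listCount-concatMap (arc? i j) (L x)) (Σ-cong (h x))))

  private
    V′-injective : ∀ x y → V′ x ≡ V′ y → x ≡ y
    V′-injective = FinP.↑ˡ-injective m
    E′-injective : ∀ x y → E′ x ≡ E′ y → x ≡ y
    E′-injective = FinP.↑ʳ-injective n
    E′≢V′ : ∀ e v → E′ e ≢ V′ v
    E′≢V′ e v = ↑ˡ≢↑ʳ v e ∘ ≡.sym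
    V′≢E′ : ∀ v e → V′ v ≢ E′ e
    V′≢E′ = ↑ˡ≢↑ʳ
    three : ∀ {a b c′ s} → a ≈ 0# → b ≈ 0# → c′ ≈ s → a + (b + c′) ≈ s
    three a≈0 b≈0 c≈s = trans (+-cong a≈0 (+-cong b≈0 c≈s)) (trans (+-identityˡ _) (+-identityˡ _))

  adj-D01-VV : ∀ a b → ℕ→R R (adj (D01 D) (V′ a) (V′ b)) ≈ 0#
  adj-D01-VV a b = trans (adj-D01 _ _) (three (pairSum-missˡ lineArc E′ E′ _ (λ p → E′≢V′ p a))
    (pairSum-missʳ _ V′ E′ _ (λ q → E′≢V′ q b)) (pairSum-missˡ _ E′ V′ _ (λ p → E′≢V′ p a)))

  adj-D01-VE : ∀ a b → ℕ→R R (adj (D01 D) (V′ a) (E′ b)) ≈ 1#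
  adj-D01-VE a b = trans (adj-D01 _ _) (trans (+-cong (pairSum-missˡ lineArc E′ E′ _ (λ p → E′≢V′ p a))
    (+-cong (pairSum-hit _ V′ E′ V′-injective E′-injective a b) (pairSum-missˡ _ E′ V′ _ (λ p → E′≢V′ p a))))
    (trans (+-identityˡ _) (+-identityʳ _)))

  adj-D01-EV : ∀ a b → ℕ→R R (adj (D01 D) (E′ a) (V′ b)) ≈ 1#
  adj-D01-EV a b = trans (adj-D01 _ _) (three (pairSum-missʳ lineArc E′ E′ _ (λ q → E′≢V′ q b))
    (pairSum-missˡ _ V′ E′ _ (λ p → V′≢E′ p a)) (pairSum-hit _ E′ V′ E′-injective V′-injective a b))

  adj-D01-EE : ∀ a b → ℕ→R R (adj (D01 D) (E′ a) (E′ b)) ≈ lineArc a b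
  adj-D01-EE a b = trans (adj-D01 _ _) (trans (+-cong (pairSum-hit lineArc E′ E′ E′-injective E′-injective a b)
    (+-cong (pairSum-missˡ _ V′ E′ _ (λ p → V′≢E′ p a)) (pairSum-missʳ _ E′ V′ _ (λ q → V′≢E′ q b))))
    (trans (+-congˡ (+-identityˡ _)) (+-identityʳ _)))

-- Matrices are indexed by
-- V ⊎ E and by V ⊎ V ⊎ E, with the first copy of V as bordering rows.
module Computation {c ℓ : Level} (R : CommutativeRing c ℓ) (n′ m : ℕ) (ψ : Fin m → Fin (suc n′) × Fin (suc n′))
  (r : ℕ) (in-regular : (v : Fin (suc n′)) → count (λ e → ⌊ proj₂ (ψ e) ≟ v ⌋) ≡ r) (x : CommutativeRing.Carrier R) where
  open CommutativeRing R hiding (zero)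
  open FinSums R
  open Determinants R
  open EnumeratedMatrices R
  open Adjacency R ψ
  open IntegerSolver R using (solve; _:=_; _:+_; _:*_; _:-_; :-_; con)
  open import Relation.Binary.Reasoning.Setoid setoid

  n : ℕ
  n = suc n′

  r# m# n# : Carrier
  r# = ℕ→R R r
  m# = ℕ→R R m
  n# = ℕ→R R n

  H-column : ∀ u → Σ (λ e → H e u) ≈ r#
  H-column u = trans (sym (count-Σ (λ e → ⌊ hd D e ≟ u ⌋))) (reflexive (≡.cong (ℕ→R R) (in-regular u)))

  A-column : ∀ w → Σ (λ u → Σ (λ e → T e u * H e w)) ≈ r#
  A-column w = begin
    Σ (λ u → Σ (λ e → T e u * H e w))  ≈⟨ Σ-swap (λ u e → T e u * H e w) ⟩
    Σ (λ e → Σ (λ u → T e u * H e w))  ≈⟨ Σ-cong (λ e → Σ-*ʳ (H e w) (λ u → T e u)) ⟩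
    Σ (λ e → Σ (λ u → T e u) * H e w)  ≈⟨ Σ-cong (λ e → trans (*-congʳ (T-row e)) (*-identityˡ (H e w))) ⟩
    Σ (λ e → H e w)                    ≈⟨ H-column w ⟩
    r#                                 ∎

  T-total : Σ (λ u → Σ (λ e → T e u)) ≈ m#
  T-total = begin
    Σ (λ u → Σ (λ e → T e u))      ≈⟨ sym (Σ-swap (λ e u → T e u)) ⟩
    Σ (λ e → Σ (λ u → T e u))      ≈⟨ Σ-cong T-row ⟩
    Σ (λ (_ : Fin m) → 1#)         ≈⟨ Σ-const {m} 1# ⟩
    m# * 1#                        ≈⟨ *-identityʳ _ ⟩
    m#                             ∎

  prod-ones : ∀ {k} → prod (λ (_ : Fin k) → 1#) ≈ 1#
  prod-ones {k} = trans (prod-const {k} 1#) (pow-ones k)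
    where
    pow-ones : ∀ k → pow R 1# k ≈ 1#
    pow-ones zero    = refl
    pow-ones (suc k) = trans (*-identityˡ _) (pow-ones k)

  unchanged : ∀ {s} (a : Carrier) (f : Fin s → Carrier) → a ≈ a + Σ (λ σ → 0# * f σ)
  unchanged a f = sym (trans (+-congˡ (Σ-zero (λ σ → zeroˡ (f σ)))) (+-identityʳ a))

  VE : Enumeration (n ℕ.+ m)
  VE = finEnum n ⊎ₑ finEnum m
  VVE : Enumeration (n ℕ.+ (n ℕ.+ m))
  VVE = finEnum n ⊎ₑ VE
  VV : Enumeration (n ℕ.+ n)
  VV = finEnum n ⊎ₑ finEnum n

  P : Mat (n ℕ.+ m)
  P i j = x * δ R i j - ℕ→R R (adj (D01 D) i j)

  P-blocks : Index VE → Index VE → Carrier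
  P-blocks (inj₁ a) (inj₁ b) = x * δ R a b
  P-blocks (inj₁ a) (inj₂ b) = - 1#
  P-blocks (inj₂ a) (inj₁ b) = - 1#
  P-blocks (inj₂ a) (inj₂ b) = x * δ R a b - lineArc a b

  det-P-blocks : Det P ≈ Det (matrix VE P-blocks)
  det-P-blocks = det-cong (λ i j → trans (reflexive (≡.sym (≡.cong₂ P (encode-decode VE i) (encode-decode VE j))))
                                         (entry (decode VE i) (decode VE j)))
    where
    δ-V′ : ∀ a b → δ R (V′ a) (V′ b) ≡ δ R a b
    δ-V′ = δ-injective V′ (FinP.↑ˡ-injective m)
    δ-E′ : ∀ a b → δ R (E′ a) (E′ b) ≡ δ R a b
    δ-E′ = δ-injective E′ (FinP.↑ʳ-injective n)
    δ-VE : ∀ a b → δ R (V′ a) (E′ b) ≈ 0#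
    δ-VE a b = reflexive (δ-apart (↑ˡ≢↑ʳ a b))
    δ-EV : ∀ a b → δ R (E′ a) (V′ b) ≈ 0#
    δ-EV a b = reflexive (δ-apart (↑ˡ≢↑ʳ b a ∘ ≡.sym))
    entry : ∀ t u → P (encode VE t) (encode VE u) ≈ P-blocks t u
    entry (inj₁ a) (inj₁ b) = trans (+-cong (*-congˡ (reflexive (δ-V′ a b))) (-‿cong (adj-D01-VV a b)))
      (solve 2 (λ x d → x :* d :- con ℤ0 := x :* d) refl x (δ R a b))
    entry (inj₁ a) (inj₂ b) = trans (+-cong (*-congˡ (δ-VE a b)) (-‿cong (adj-D01-VE a b)))
      (solve 1 (λ x → x :* con ℤ0 :- con ℤ1 := :- con ℤ1) refl x)
    entry (inj₂ a) (inj₁ b) = trans (+-cong (*-congˡ (δ-EV a b)) (-‿cong (adj-D01-EV a b)))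
      (solve 1 (λ x → x :* con ℤ0 :- con ℤ1 := :- con ℤ1) refl x)
    entry (inj₂ a) (inj₂ b) = +-cong (*-congˡ (reflexive (δ-E′ a b))) (-‿cong (adj-D01-EE a b))

  -- Step 1: subtract vertex row 0 from the other vertex rows; they become
  -- x (e_v - e_0) on V and 0 on E.  Factoring out x leaves P₁.
  P₁ : Index VE → Index VE → Carrier
  P₁ (inj₁ zero)    u        = P-blocks (inj₁ zero) u
  P₁ (inj₁ (suc v)) (inj₁ w) = δ R (suc v) w - δ R zero w
  P₁ (inj₁ (suc v)) (inj₂ e) = 0#
  P₁ (inj₂ e)       u        = P-blocks (inj₂ e) u

  det-clear-vertex-rows : Det (matrix VE P-blocks) ≈ pow R x n′ * Det (matrix VE P₁)
  det-clear-vertex-rows = begin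
    Det (matrix VE P-blocks)             ≈⟨ sym (det-rowAddAllₑ VE P-blocks subtracted (λ _ → inj₁ zero) coeff ok
                                              (λ σ u → sym (unchanged {1} _ (λ _ → P-blocks (inj₁ zero) u))) (λ t u → refl)) ⟩
    Det (matrix VE subtracted)           ≈⟨ det-scaleₑ VE P₁ subtracted scale factored ⟩
    prod (scale ∘ decode VE) * Det (matrix VE P₁) ≈⟨ *-congʳ prod-scale ⟩
    pow R x n′ * Det (matrix VE P₁)      ∎
    where
    coeff : Index VE → Fin 1 → Carrier
    coeff (inj₁ zero)    _ = 0#
    coeff (inj₁ (suc _)) _ = - 1#
    coeff (inj₂ _)       _ = 0#
    ok : ∀ t σ → inj₁ zero ≢ t ⊎ coeff t σ ≈ 0#
    ok (inj₁ zero)    σ = inj₂ refl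
    ok (inj₁ (suc v)) σ = inj₁ (λ ())
    ok (inj₂ e)       σ = inj₂ refl
    subtracted : Index VE → Index VE → Carrier
    subtracted t u = P-blocks t u + Σ (λ σ → coeff t σ * P-blocks (inj₁ zero) u)
    scale : Index VE → Carrier
    scale (inj₁ zero)    = 1#
    scale (inj₁ (suc _)) = x
    scale (inj₂ _)       = 1#
    factored : ∀ t u → subtracted t u ≈ scale t * P₁ t u
    factored (inj₁ zero) u = solve 2 (λ p q → p :+ (con ℤ0 :* q :+ con ℤ0) := con ℤ1 :* p) refl
      (P-blocks (inj₁ zero) u) (P-blocks (inj₁ zero) u)
    factored (inj₁ (suc v)) (inj₁ w) = solve 3 (λ x a b → x :* a :+ (:- con ℤ1 :* (x :* b) :+ con ℤ0) := x :* (a :- b)) refl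
      x (δ R (suc v) w) (δ R zero w)
    factored (inj₁ (suc v)) (inj₂ e) = solve 1 (λ x → :- con ℤ1 :+ (:- con ℤ1 :* :- con ℤ1 :+ con ℤ0) := x :* con ℤ0) refl x
    factored (inj₂ e) u = solve 2 (λ p q → p :+ (con ℤ0 :* q :+ con ℤ0) := con ℤ1 :* p) refl
      (P-blocks (inj₂ e) u) (P-blocks (inj₁ zero) u)
    prod-scale : prod (scale ∘ decode VE) ≈ pow R x n′
    prod-scale = begin
      prod (scale ∘ decode VE)                                    ≈⟨ prod-⊎ (finEnum n) (finEnum m) scale ⟩
      (1# * prod (λ (_ : Fin n′) → x)) * prod (λ (_ : Fin m) → 1#) ≈⟨ *-cong (*-congˡ (prod-const {n′} x)) (prod-ones {m}) ⟩
      (1# * pow R x n′) * 1#                                      ≈⟨ solve 1 (λ p → (con ℤ1 :* p) :* con ℤ1 := p) refl (pow R x n′) ⟩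
      pow R x n′                                                  ∎

  -- Step 2 (bordering): P₁ has the same determinant as the matrix B on
  -- V ⊎ V ⊎ E below, whose extra rows and columns (the first copy of V)
  -- carry the incidence matrices: eliminating H with the identity block
  -- turns x I - H Tᵀ on E back into the lower right block of P₁.
  B : Index VVE → Index VVE → Carrier
  B (inj₁ u)        (inj₁ w)        = δ R u w
  B (inj₁ u)        (inj₂ (inj₁ w)) = 0#
  B (inj₁ u)        (inj₂ (inj₂ e)) = T e u
  B (inj₂ (inj₁ v)) (inj₁ w)        = 0#
  B (inj₂ (inj₁ v)) (inj₂ t)        = P₁ (inj₁ v) t
  B (inj₂ (inj₂ e)) (inj₁ u)        = H e u
  B (inj₂ (inj₂ e)) (inj₂ (inj₁ w)) = - 1#
  B (inj₂ (inj₂ e)) (inj₂ (inj₂ q)) = x * δ R e q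

  det-bordered : Det (matrix VVE B) ≈ Det (matrix VE P₁)
  det-bordered = begin
    Det (matrix VVE B)          ≈⟨ sym (det-rowAddAllₑ VVE B eliminated inj₁ coeff ok (λ σ u → refl) added) ⟩
    Det (matrix VVE eliminated) ≈⟨ det-block-upperₑ (finEnum n) VE eliminated (λ { (inj₁ v) u → refl ; (inj₂ e) u → refl }) ⟩
    Det (matrix (finEnum n) (λ u w → δ R u w)) * Det (matrix VE (λ t u → eliminated (inj₂ t) (inj₂ u)))
                                ≈⟨ *-cong (det-identity {n}) (det-congₑ VE _ _ lower-right) ⟩
    1# * Det (matrix VE P₁)     ≈⟨ *-identityˡ _ ⟩
    Det (matrix VE P₁)          ∎
    where
    eliminated : Index VVE → Index VVE → Carrier
    eliminated (inj₂ (inj₂ e)) (inj₁ u)        = 0#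
    eliminated (inj₂ (inj₂ e)) (inj₂ (inj₁ w)) = - 1#
    eliminated (inj₂ (inj₂ e)) (inj₂ (inj₂ q)) = x * δ R e q - Σ (λ u → H e u * T q u)
    eliminated t               u               = B t u
    coeff : Index VVE → Fin n → Carrier
    coeff (inj₂ (inj₂ e)) σ = - H e σ
    coeff _               σ = 0#
    ok : ∀ t σ → inj₁ σ ≢ t ⊎ coeff t σ ≈ 0#
    ok (inj₁ _)        σ = inj₂ refl
    ok (inj₂ (inj₁ _)) σ = inj₂ refl
    ok (inj₂ (inj₂ _)) σ = inj₁ (λ ())
    added : ∀ t u → eliminated t u ≈ B t u + Σ (λ σ → coeff t σ * B (inj₁ σ) u)
    added (inj₁ u)        c = unchanged _ (λ σ → B (inj₁ σ) c)
    added (inj₂ (inj₁ v)) c = unchanged _ (λ σ → B (inj₁ σ) c)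
    added (inj₂ (inj₂ e)) (inj₁ w) = sym (begin
      H e w + Σ (λ σ → - H e σ * δ R σ w)  ≈⟨ +-congˡ (Σ-cong (λ σ → *-comm (- H e σ) (δ R σ w))) ⟩
      H e w + Σ (λ σ → δ R σ w * - H e σ)  ≈⟨ +-congˡ (Σ-δ w (λ σ → - H e σ)) ⟩
      H e w + - H e w                      ≈⟨ -‿inverseʳ _ ⟩
      0#                                   ∎)
    added (inj₂ (inj₂ e)) (inj₂ (inj₁ w)) = sym (trans (+-congˡ (Σ-zero (λ σ → zeroʳ (- H e σ)))) (+-identityʳ _))
    added (inj₂ (inj₂ e)) (inj₂ (inj₂ q)) = +-congˡ (begin
      - Σ (λ u → H e u * T q u)    ≈⟨ sym (Σ-neg (λ u → H e u * T q u)) ⟩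
      Σ (λ u → - (H e u * T q u))  ≈⟨ Σ-cong (λ u → solve 2 (λ a b → :- (a :* b) := :- a :* b) refl (H e u) (T q u)) ⟩
      Σ (λ σ → - H e σ * T q σ)    ∎)
    lower-right : ∀ t u → eliminated (inj₂ t) (inj₂ u) ≈ P₁ t u
    lower-right (inj₁ v) u        = refl
    lower-right (inj₂ e) (inj₁ w) = refl
    lower-right (inj₂ e) (inj₂ q) = +-congˡ (-‿cong (H·Tᵀ e q))

  -- Step 3: adding all bordering rows to row 0 of the second copy of V clears
  -- its E part (each arc has one tail).
  C : Index VVE → Index VVE → Carrier
  C (inj₂ (inj₁ zero)) (inj₁ w)        = 1#
  C (inj₂ (inj₁ zero)) (inj₂ (inj₁ w)) = x * δ R zero w
  C (inj₂ (inj₁ zero)) (inj₂ (inj₂ e)) = 0#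
  C t                  u               = B t u

  det-clear-row0 : Det (matrix VVE C) ≈ Det (matrix VVE B)
  det-clear-row0 = det-rowAddAllₑ VVE B C inj₁ coeff ok (λ σ u → refl) added
    where
    coeff : Index VVE → Fin n → Carrier
    coeff (inj₂ (inj₁ zero)) σ = 1#
    coeff _                  σ = 0#
    ok : ∀ t σ → inj₁ σ ≢ t ⊎ coeff t σ ≈ 0#
    ok (inj₁ _)              σ = inj₂ refl
    ok (inj₂ (inj₁ zero))    σ = inj₁ (λ ())
    ok (inj₂ (inj₁ (suc _))) σ = inj₂ refl
    ok (inj₂ (inj₂ _))       σ = inj₂ refl
    added : ∀ t u → C t u ≈ B t u + Σ (λ σ → coeff t σ * B (inj₁ σ) u)
    added (inj₁ u)              c = unchanged _ (λ σ → B (inj₁ σ) c)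
    added (inj₂ (inj₁ (suc v))) c = unchanged _ (λ σ → B (inj₁ σ) c)
    added (inj₂ (inj₂ e))       c = unchanged _ (λ σ → B (inj₁ σ) c)
    added (inj₂ (inj₁ zero)) (inj₁ w) = sym (begin
      0# + Σ (λ σ → 1# * δ R σ w)  ≈⟨ +-identityˡ _ ⟩
      Σ (λ σ → 1# * δ R σ w)       ≈⟨ Σ-cong (λ σ → *-identityˡ (δ R σ w)) ⟩
      Σ (λ σ → δ R σ w)            ≈⟨ Σ-δ-1 w ⟩
      1#                           ∎)
    added (inj₂ (inj₁ zero)) (inj₂ (inj₁ w)) =
      sym (trans (+-congˡ (Σ-zero {n} {λ σ → 1# * 0#} (λ σ → zeroʳ 1#))) (+-identityʳ _))
    added (inj₂ (inj₁ zero)) (inj₂ (inj₂ e)) = sym (begin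
      - 1# + Σ (λ σ → 1# * T e σ)  ≈⟨ +-congˡ (trans (Σ-cong (λ σ → *-identityˡ (T e σ))) (T-row e)) ⟩
      - 1# + 1#                    ≈⟨ -‿inverseˡ _ ⟩
      0#                           ∎)

  -- Step 4: multiply the bordering rows by x, then subtract from row u the
  -- arc rows e weighted by T e u.  Their E part vanishes and their V parts
  -- become x I - Tᵀ H = x I - A(D) and the column of out-degrees.
  E-cleared : Index VVE → Index VVE → Carrier
  E-cleared (inj₁ u) (inj₁ w)        = x * δ R u w - Σ (λ e → T e u * H e w)
  E-cleared (inj₁ u) (inj₂ (inj₁ w)) = Σ (λ e → T e u)
  E-cleared (inj₁ u) (inj₂ (inj₂ q)) = 0#
  E-cleared (inj₂ t) c               = C (inj₂ t) c

  det-clear-arc-columns : Det (matrix VVE E-cleared) ≈ pow R x n * Det (matrix VVE C)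
  det-clear-arc-columns = begin
    Det (matrix VVE E-cleared)  ≈⟨ det-rowAddAllₑ VVE scaled E-cleared (inj₂ ∘ inj₂) coeff ok (λ σ u → refl) added ⟩
    Det (matrix VVE scaled)     ≈⟨ det-scaleₑ VVE C scaled scale (λ { (inj₁ u) c → refl ; (inj₂ t) c → sym (*-identityˡ _) }) ⟩
    prod (scale ∘ decode VVE) * Det (matrix VVE C)
      ≈⟨ *-congʳ (trans (prod-⊎ (finEnum n) VE scale) (trans (*-cong (prod-const {n} x) (prod-ones {n ℕ.+ m})) (*-identityʳ _))) ⟩
    pow R x n * Det (matrix VVE C) ∎
    where
    scale : Index VVE → Carrier
    scale (inj₁ _) = x
    scale (inj₂ _) = 1#
    scaled : Index VVE → Index VVE → Carrier
    scaled (inj₁ u) c = x * C (inj₁ u) c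
    scaled (inj₂ t) c = C (inj₂ t) c
    coeff : Index VVE → Fin m → Carrier
    coeff (inj₁ u) σ = - T σ u
    coeff (inj₂ _) σ = 0#
    ok : ∀ t σ → inj₂ (inj₂ σ) ≢ t ⊎ coeff t σ ≈ 0#
    ok (inj₁ _) σ = inj₁ (λ ())
    ok (inj₂ _) σ = inj₂ refl
    added : ∀ t u → E-cleared t u ≈ scaled t u + Σ (λ σ → coeff t σ * scaled (inj₂ (inj₂ σ)) u)
    added (inj₁ u) (inj₁ w) = +-congˡ (begin
      - Σ (λ e → T e u * H e w)    ≈⟨ sym (Σ-neg (λ e → T e u * H e w)) ⟩
      Σ (λ e → - (T e u * H e w))  ≈⟨ Σ-cong (λ e → solve 2 (λ a b → :- (a :* b) := :- a :* b) refl (T e u) (H e w)) ⟩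
      Σ (λ e → - T e u * H e w)    ∎)
    added (inj₁ u) (inj₂ (inj₁ w)) = sym (begin
      x * 0# + Σ (λ σ → - T σ u * - 1#)
        ≈⟨ +-cong (zeroʳ x) (Σ-cong (λ σ → solve 1 (λ a → :- a :* :- con ℤ1 := a) refl (T σ u))) ⟩
      0# + Σ (λ σ → T σ u)          ≈⟨ +-identityˡ _ ⟩
      Σ (λ σ → T σ u)               ∎)
    added (inj₁ u) (inj₂ (inj₂ q)) = sym (begin
      x * T q u + Σ (λ σ → - T σ u * (x * δ R σ q))
        ≈⟨ +-congˡ (Σ-cong (λ σ → solve 3 (λ a x d → :- a :* (x :* d) := d :* (:- (x :* a))) refl (T σ u) x (δ R σ q))) ⟩
      x * T q u + Σ (λ σ → δ R σ q * - (x * T σ u)) ≈⟨ +-congˡ (Σ-δ q (λ σ → - (x * T σ u))) ⟩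
      x * T q u + - (x * T q u)     ≈⟨ -‿inverseʳ _ ⟩
      0#                            ∎)
    added (inj₂ t) c = unchanged _ (λ σ → scaled (inj₂ (inj₂ σ)) c)

  -- Step 5: the E columns now vanish outside the E rows, where x I remains;
  -- regroup V ⊎ (V ⊎ E) as (V ⊎ V) ⊎ E and split off x^m.
  K : Index VV → Index VV → Carrier
  K t u = E-cleared (⊎-assoc (inj₁ t)) (⊎-assoc (inj₁ u))

  det-split-arcs : Det (matrix VVE E-cleared) ≈ Det (matrix VV K) * pow R x m
  det-split-arcs = begin
    Det (matrix VVE E-cleared)
      ≈⟨ det-⊎-assoc n n m E-cleared ⟩
    Det (matrix (VV ⊎ₑ finEnum m) (λ t u → E-cleared (⊎-assoc t) (⊎-assoc u)))
      ≈⟨ det-block-lowerₑ VV (finEnum m) (λ t u → E-cleared (⊎-assoc t) (⊎-assoc u)) upper-right ⟩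
    Det (matrix VV K) * Det (matrix (finEnum m) (λ e q → E-cleared (inj₂ (inj₂ e)) (inj₂ (inj₂ q))))
      ≈⟨ *-congˡ (det-scalar {m} x _ (λ i j → refl)) ⟩
    Det (matrix VV K) * pow R x m ∎
    where
    upper-right : ∀ t q → E-cleared (⊎-assoc (inj₁ t)) (inj₂ (inj₂ q)) ≈ 0#
    upper-right (inj₁ u)       q = refl
    upper-right (inj₂ zero)    q = refl
    upper-right (inj₂ (suc v)) q = refl

  -- Step 6: multiply row 0 of the second copy of V by x - r and subtract all
  -- rows of the first copy.  By in-regularity its first-copy part becomes 0,
  -- so K is block triangular with diagonal blocks x I - A(D) and L.
  L : Fin n → Fin n → Carrier
  L zero    w = (x - r#) * (x * δ R zero w) - Σ (λ u → Σ (λ e → T e u))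
  L (suc v) w = δ R (suc v) w - δ R zero w

  det-split-charPoly : (x - r#) * Det (matrix VV K) ≈ charPolyAt R D x * Det L
  det-split-charPoly = begin
    (x - r#) * Det (matrix VV K)  ≈⟨ *-congʳ (sym prod-scale) ⟩
    prod (scale ∘ decode VV) * Det (matrix VV K) ≈⟨ sym (det-scaleₑ VV K scaled scale scaled-rows) ⟩
    Det (matrix VV scaled)        ≈⟨ sym (det-rowAddAllₑ VV scaled K₂ inj₁ coeff ok (λ σ u → refl) added) ⟩
    Det (matrix VV K₂)            ≈⟨ det-block-upperₑ (finEnum n) (finEnum n) K₂ (λ { zero u → refl ; (suc v) u → refl }) ⟩
    Det (matrix (finEnum n) (λ u w → K₂ (inj₁ u) (inj₁ w))) * Det L
      ≈⟨ *-congʳ (det-cong (λ u w → +-congˡ {x * δ R u w} (-‿cong (sym (adj-D u w))))) ⟩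
    charPolyAt R D x * Det L      ∎
    where
    scale : Index VV → Carrier
    scale (inj₂ zero) = x - r#
    scale _           = 1#
    scaled : Index VV → Index VV → Carrier
    scaled (inj₂ zero) c = (x - r#) * K (inj₂ zero) c
    scaled t           c = K t c
    scaled-rows : ∀ t u → scaled t u ≈ scale t * K t u
    scaled-rows (inj₁ u)       c = sym (*-identityˡ _)
    scaled-rows (inj₂ zero)    c = refl
    scaled-rows (inj₂ (suc v)) c = sym (*-identityˡ _)
    prod-scale : prod (scale ∘ decode VV) ≈ x - r#
    prod-scale = begin
      prod (scale ∘ decode VV)                                              ≈⟨ prod-⊎ (finEnum n) (finEnum n) scale ⟩
      prod (λ (_ : Fin n) → 1#) * ((x - r#) * prod (λ (_ : Fin n′) → 1#))  ≈⟨ *-cong (prod-ones {n}) (*-congˡ (prod-ones {n′})) ⟩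
      1# * ((x - r#) * 1#)     ≈⟨ solve 1 (λ a → con ℤ1 :* (a :* con ℤ1) := a) refl (x - r#) ⟩
      x - r#                   ∎
    K₂ : Index VV → Index VV → Carrier
    K₂ (inj₂ zero) (inj₁ w) = 0#
    K₂ (inj₂ zero) (inj₂ w) = L zero w
    K₂ (inj₂ (suc v)) (inj₂ w) = L (suc v) w
    K₂ t c = scaled t c
    coeff : Index VV → Fin n → Carrier
    coeff (inj₂ zero) σ = - 1#
    coeff _           σ = 0#
    ok : ∀ t σ → inj₁ σ ≢ t ⊎ coeff t σ ≈ 0#
    ok (inj₁ _)       σ = inj₂ refl
    ok (inj₂ zero)    σ = inj₁ (λ ())
    ok (inj₂ (suc _)) σ = inj₂ refl
    added : ∀ t u → K₂ t u ≈ scaled t u + Σ (λ σ → coeff t σ * scaled (inj₁ σ) u)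
    added (inj₁ u)       c = unchanged _ (λ σ → scaled (inj₁ σ) c)
    added (inj₂ (suc v)) (inj₁ w) = unchanged _ (λ σ → scaled (inj₁ σ) (inj₁ w))
    added (inj₂ (suc v)) (inj₂ w) = unchanged _ (λ σ → scaled (inj₁ σ) (inj₂ w))
    added (inj₂ zero) (inj₁ w) = sym (begin
      (x - r#) * 1# + Σ (λ σ → - 1# * (x * δ R σ w - Σ (λ e → T e σ * H e w)))
        ≈⟨ +-congˡ (Σ-cong (λ σ → solve 2 (λ a b → :- con ℤ1 :* (a :- b) := b :+ :- a) refl
                                     (x * δ R σ w) (Σ (λ e → T e σ * H e w)))) ⟩
      (x - r#) * 1# + Σ (λ σ → Σ (λ e → T e σ * H e w) + - (x * δ R σ w))
        ≈⟨ +-congˡ (Σ-+ (λ σ → Σ (λ e → T e σ * H e w)) (λ σ → - (x * δ R σ w))) ⟩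
      (x - r#) * 1# + (Σ (λ σ → Σ (λ e → T e σ * H e w)) + Σ (λ σ → - (x * δ R σ w)))
        ≈⟨ +-congˡ (+-cong (A-column w) (trans (Σ-neg (λ σ → x * δ R σ w))
                                               (-‿cong (trans (Σ-*ˡ x (λ σ → δ R σ w)) (*-congˡ (Σ-δ-1 w)))))) ⟩
      (x - r#) * 1# + (r# + - (x * 1#))
        ≈⟨ solve 2 (λ x r → (x :- r) :* con ℤ1 :+ (r :+ :- (x :* con ℤ1)) := con ℤ0) refl x r# ⟩
      0# ∎)
    added (inj₂ zero) (inj₂ w) = +-congˡ (sym (begin
      Σ (λ σ → - 1# * Σ (λ e → T e σ))
        ≈⟨ Σ-cong (λ σ → solve 1 (λ a → :- con ℤ1 :* a := :- a) refl (Σ (λ e → T e σ))) ⟩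
      Σ (λ σ → - Σ (λ e → T e σ))      ≈⟨ Σ-neg (λ σ → Σ (λ e → T e σ)) ⟩
      - Σ (λ u → Σ (λ e → T e u))      ∎))

  -- Step 7: adding multiples of the rows e_v - e_0 (v ≠ 0) clears row 0 of L
  -- except for its pivot, which is x² - r x - m n.
  det-last-pivot : Det L ≈ (x * x - r# * x) - m# * n#
  det-last-pivot = begin
    Det L                     ≈⟨ sym (det-rowAddAll L L′ suc coeff ok (λ σ c → refl) added) ⟩
    Det L′                    ≈⟨ det-pivot L′ (λ { zero 0≢0 → ⊥-elim (0≢0 ≡.refl) ; (suc j) _ → refl }) ⟩
    pivot * Det (minor L′ zero)
      ≈⟨ *-congˡ (trans (det-cong {n′} (λ i j → trans (+-congʳ (δ-suc i j)) minus-zero)) (det-identity {n′})) ⟩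
    pivot * 1#                ≈⟨ *-identityʳ _ ⟩
    pivot                     ≈⟨ +-cong (+-congˡ (-‿cong T-total)) (*-cong T-total (Σ-const {n′} (0# - 1#))) ⟩
    (x - r#) * (x * 1#) - m# + m# * (ℕ→R R n′ * (0# - 1#))
      ≈⟨ solve 4 (λ x r k M → (x :- r) :* (x :* con ℤ1) :- M :+ M :* (k :* (con ℤ0 :- con ℤ1))
                              := (x :* x :- r :* x) :- M :* (con ℤ1 :+ k)) refl x r# (ℕ→R R n′) m# ⟩
    (x * x - r# * x) - m# * n# ∎
    where
    total : Carrier
    total = Σ (λ u → Σ (λ e → T e u))
    minus-zero : ∀ {a} → a - 0# ≈ a
    minus-zero {a} = solve 1 (λ a → a :- con ℤ0 := a) refl a
    pivot : Carrier
    pivot = L zero zero + total * Σ (λ (_ : Fin n′) → 0# - 1#)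
    L′ : Fin n → Fin n → Carrier
    L′ zero    zero    = pivot
    L′ zero    (suc w) = 0#
    L′ (suc v) j       = L (suc v) j
    coeff : Fin n → Fin n′ → Carrier
    coeff zero    σ = total
    coeff (suc _) σ = 0#
    ok : ∀ t σ → suc σ ≢ t ⊎ coeff t σ ≈ 0#
    ok zero    σ = inj₁ (λ ())
    ok (suc _) σ = inj₂ refl
    added : ∀ t u → L′ t u ≈ L t u + Σ (λ σ → coeff t σ * L (suc σ) u)
    added zero    zero    = +-congˡ (sym (Σ-*ˡ total (λ (_ : Fin n′) → 0# - 1#)))
    added zero    (suc w) = sym (begin
      L zero (suc w) + Σ (λ σ → total * (δ R (suc σ) (suc w) - 0#))
        ≈⟨ +-congˡ (Σ-cong (λ σ → *-congˡ (trans minus-zero (δ-suc σ w)))) ⟩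
      L zero (suc w) + Σ (λ σ → total * δ R σ w)
        ≈⟨ +-congˡ (trans (Σ-*ˡ total (λ σ → δ R σ w)) (*-congˡ (Σ-δ-1 w))) ⟩
      ((x - r#) * (x * 0#) - total) + total * 1#
        ≈⟨ solve 3 (λ x r t → ((x :- r) :* (x :* con ℤ0) :- t) :+ t :* con ℤ1 := con ℤ0) refl x r# total ⟩
      0# ∎)
    added (suc v) c = unchanged _ (λ σ → L (suc σ) c)

  identity : (x * (x - r#)) * charPolyAt R (D01 D) x ≈ (pow R x m * ((x * x - r# * x) - m# * n#)) * charPolyAt R D x
  identity = begin
    (x * (x - r#)) * Det P                               ≈⟨ *-congˡ (trans det-P-blocks det-clear-vertex-rows) ⟩
    (x * (x - r#)) * (pow R x n′ * Det (matrix VE P₁))   ≈⟨ *-congˡ (*-congˡ (sym (trans det-clear-row0 det-bordered))) ⟩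
    (x * (x - r#)) * (pow R x n′ * Det (matrix VVE C))
      ≈⟨ solve 4 (λ x r p d → (x :* (x :- r)) :* (p :* d) := (x :- r) :* ((x :* p) :* d)) refl x r# (pow R x n′) (Det (matrix VVE C)) ⟩
    (x - r#) * (pow R x n * Det (matrix VVE C))          ≈⟨ *-congˡ (sym det-clear-arc-columns) ⟩
    (x - r#) * Det (matrix VVE E-cleared)                ≈⟨ *-congˡ det-split-arcs ⟩
    (x - r#) * (Det (matrix VV K) * pow R x m)
      ≈⟨ solve 3 (λ a d p → a :* (d :* p) := p :* (a :* d)) refl (x - r#) (Det (matrix VV K)) (pow R x m) ⟩
    pow R x m * ((x - r#) * Det (matrix VV K))           ≈⟨ *-congˡ det-split-charPoly ⟩
    pow R x m * (charPolyAt R D x * Det L)               ≈⟨ *-congˡ (*-congˡ det-last-pivot) ⟩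
    pow R x m * (charPolyAt R D x * ((x * x - r# * x) - m# * n#))
      ≈⟨ solve 3 (λ p c l → p :* (c :* l) := (p :* l) :* c) refl (pow R x m) (charPolyAt R D x) ((x * x - r# * x) - m# * n#) ⟩
    (pow R x m * ((x * x - r# * x) - m# * n#)) * charPolyAt R D x ∎

-- Theorem 4.8.  A digraph with an arc has a vertex; with no vertices and no
-- arcs both characteristic polynomials are empty determinants.
theorem4p8 : ∀ {c ℓ : Level} (R : CommutativeRing c ℓ) (D : Digraph) (r : ℕ) →
    Regular D r → (x : CommutativeRing.Carrier R) →
    let open CommutativeRing R in
    (x * (x - ℕ→R R r)) * charPolyAt R (D01 D) x
      ≈ (pow R x (nE D) * ((x * x - ℕ→R R r * x) - ℕ→R R (nE D) * ℕ→R R (nV D))) * charPolyAt R D x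
theorem4p8 R record { nV = suc n′ ; nE = m ; ψ = ψ } r regular x = Computation.identity R n′ m ψ r (proj₂ regular) x
theorem4p8 R record { nV = zero ; nE = suc m ; ψ = ψ } r regular x with proj₁ (ψ zero)
... | ()
theorem4p8 R record { nV = zero ; nE = zero ; ψ = ψ } r regular x =
  solve 2 (λ x r → (x :* (x :- r)) :* con ℤ1 := (con ℤ1 :* ((x :* x :- r :* x) :- con ℤ0 :* con ℤ0)) :* con ℤ1)
    (CommutativeRing.refl R) x (ℕ→R R r)
  where open IntegerSolver R using (solve; _:=_; _:-_; _:*_; con)
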